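{- Let $p$ be a prime and $n,k,l$ nonnegative integers with $k,l\le n$. Then $$\nu_{n,k,l}(p)=G_{k,n}+(p^l-1)G_{k-1,n-1},$$ and moreover $\nu_{n,k,l}(p)/\nu_{n,n-k,n-l}(p)=p^{k+l-n}$.
   Context: For an $l$-dimensional subspace $U\subset\mathbb{F}_p^n$, $\nu_{n,k,l}(p)=\sum_W p^{\dim(W\cap U)}$, summed over all $k$-dimensional subspaces $W\subset\mathbb{F}_p^n$ (independent of $U$). $G_{a,b}$ is the number of $a$-dimensional subspaces of $\mathbb{F}_p^b$, given by $[b]!/([a]![b-a]!)$ with $[m]=(p^m-1)/(p-1)$, $[m]!=\prod_{i=1}^m[i]$ (and $G_{a,b}=0$ if $a<0$). -}

module Defs where

open import Data.Nat using (ℕ; zero; suc; _+_; _*_; _∸_; _^_; _≤ᵇ_; NonZero)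
open import Data.Nat.Properties using (m*n≢0)
open import Data.Nat.DivMod using (_/_; _mod_)
open import Data.Bool using (Bool; true; false; _∧_; if_then_else_)
open import Data.Fin using (Fin; toℕ) renaming (zero to fzero)
import Data.Fin.Properties as FinP
open import Data.Vec using (Vec; []; _∷_; replicate; zipWith) renaming (map to vmap)
import Data.Vec.Properties as VecP
open import Data.List using (List; []; _∷_; _++_; map; concatMap; filterᵇ; foldr; allFin; upTo)
open import Data.Bool.ListAction using (all; any)
open import Relation.Nullary.Decidable using (⌊_⌋)

-- Gaussian integers / binomials
-- [m] = (p^m - 1)/(p - 1) = 1 + p + ... + p^(m-1), written recursively.

qint : ℕ → ℕ → ℕ
qint p zero    = 0
qint p (suc m) = suc (p * qint p m)

qfact : ℕ → ℕ → ℕ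
qfact p zero    = 1
qfact p (suc m) = qint p (suc m) * qfact p m

qfact-nz : ∀ p m → NonZero (qfact p m)
qfact-nz p zero    = _
qfact-nz p (suc m) = m*n≢0 (qint p (suc m)) (qfact p m) {{_}} {{qfact-nz p m}}

qfact2-nz : ∀ p a c → NonZero (qfact p a * qfact p c)
qfact2-nz p a c = m*n≢0 (qfact p a) (qfact p c) {{qfact-nz p a}} {{qfact-nz p c}}

-- G_{a,b} = [b]! / ([a]! [b-a]!)  (number of a-dim subspaces of F_p^b);
-- set to 0 when a > b.
G : ℕ → ℕ → ℕ → ℕ
G p a b = if a ≤ᵇ b
          then _/_ (qfact p b) (qfact p a * qfact p (b ∸ a)) {{qfact2-nz p a (b ∸ a)}}
          else 0

-- Gpred p a b = G_{a-1,b-1}, with the convention G_{-1,_} = 0.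
Gpred : ℕ → ℕ → ℕ → ℕ
Gpred p zero    b = 0
Gpred p (suc a) b = G p a (b ∸ 1)

-- Linear algebra over F_p = Fin p (arithmetic mod p), vectors of F_p^n
-- as Vec (Fin p) n, subsets of F_p^n as lists of vectors.

module LinAlg (p : ℕ) .{{_ : NonZero p}} where

  F : Set
  F = Fin p

  _+F_ : F → F → F
  a +F b = (toℕ a + toℕ b) mod p

  _*F_ : F → F → F
  a *F b = (toℕ a * toℕ b) mod p

  0F : F
  0F = 0 mod p

  V : ℕ → Set
  V n = Vec F n

  module _ {n : ℕ} where

    _+V_ : V n → V n → V n
    _+V_ = zipWith _+F_

    _·V_ : F → V n → V n
    c ·V v = vmap (c *F_) v

    0V : V n
    0V = replicate n 0F

    _=V_ : V n → V n → Bool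
    u =V v = ⌊ VecP.≡-dec FinP._≟_ u v ⌋

    _∈ᵇ_ : V n → List (V n) → Bool
    v ∈ᵇ S = any (v =V_) S

  allVecs : ∀ m → List (V m)
  allVecs zero    = [] ∷ []
  allVecs (suc m) = concatMap (λ a → map (a ∷_) (allVecs m)) (allFin p)

  powerset : ∀ {A : Set} → List A → List (List A)
  powerset []       = [] ∷ []
  powerset (x ∷ xs) = map (x ∷_) (powerset xs) ++ powerset xs

  allSubsets : ∀ n → List (List (V n))
  allSubsets n = powerset (allVecs n)

  module _ {n : ℕ} where

    isSubspace : List (V n) → Bool
    isSubspace S =
      (0V ∈ᵇ S)
      ∧ all (λ x → all (λ y → (x +V y) ∈ᵇ S) S) S
      ∧ all (λ c → all (λ x → (c ·V x) ∈ᵇ S) S) (allFin p)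

    lincomb : ∀ {d} → V d → Vec (V n) d → V n
    lincomb []       []       = 0V
    lincomb (c ∷ cs) (b ∷ bs) = (c ·V b) +V lincomb cs bs

    linIndep : ∀ {d} → Vec (V n) d → Bool
    linIndep {d} b =
      all (λ c → if lincomb c b =V 0V then c =V 0V else true) (allVecs d)

    isBasisOf : ∀ {d} → Vec (V n) d → List (V n) → Bool
    isBasisOf {d} b S =
      Data.Vec.foldr _ (λ x r → (x ∈ᵇ S) ∧ r) true b
      ∧ linIndep b
      ∧ all (λ x → any (λ c → lincomb c b =V x) (allVecs d)) S

    tuples : ∀ d → List (V n) → List (Vec (V n) d)
    tuples zero    S = [] ∷ []
    tuples (suc d) S = concatMap (λ x → map (x ∷_) (tuples d S)) S

    hasDim : List (V n) → ℕ → Bool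
    hasDim S d = any (λ b → isBasisOf b S) (tuples d S)

    _∩_ : List (V n) → List (V n) → List (V n)
    W ∩ U = filterᵇ (_∈ᵇ U) W

  pdim : ∀ {n} → List (V n) → ℕ
  pdim {n} S = foldr (λ d r → (if hasDim S d then p ^ d else 0) + r) 0 (upTo (suc n))

  -- ν_{n,k,l}(p) relative to the subspace U: Σ_{W k-dim subspace} p^{dim(W ∩ U)}
  ν : ∀ {n} → (U : List (V n)) → (k : ℕ) → ℕ
  ν {n} U k = foldr (λ W r → (if isSubspace W ∧ hasDim W k then pdim (W ∩ U) else 0) + r)
                    0 (allSubsets n)

module Submission where

-- Since p^{dim(W ∩ U)} = |W ∩ U|, ν counts the pairs (W, v) with v ∈ W ∩ U; summing over v first
-- gives ν = Σ_{v ∈ U} #{k-dimensional W ∋ v}.  The zero vector lies in all G_{k,n} such W, and each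
-- of the p^l − 1 nonzero vectors of U in G_{k−1,n−1} of them.  Both subspace counts come from
-- double counting independent tuples: an independent (k − i)-tuple b extending a fixed independent
-- i-tuple a spans, together with a, exactly one k-dimensional W ⊇ a; inside a given such W there
-- are ∏_{j<k−i} (p^k − p^{i+j}) such b, and in F_p^n there are ∏_{j<k−i} (p^n − p^{i+j}).  The
-- duality ν_{n,k,l} p^n = p^{k+l} ν_{n,n−k,n−l} is then an identity of Gaussian binomials, following
-- from G_{k,n} = G_{n−k,n} and the two q-Pascal rules.

open import Defs
open import Data.Bool using (Bool; true; false; _∧_; _∨_; not; if_then_else_)
import Data.Bool.Properties as Boolₚ
open import Data.Bool.ListAction using (all; any)
open import Data.Empty using (⊥; ⊥-elim)
open import Data.Fin using (Fin; toℕ) renaming (zero to fzero; suc to fsuc)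
import Data.Fin.Properties as Finₚ
open import Data.List
  using (List; []; _∷_; _++_; map; concatMap; foldr; allFin; tabulate; length; applyUpTo; upTo)
import Data.List.Properties as Listₚ
open import Data.List.Relation.Unary.All.Properties using (All¬⇒¬Any; ¬Any⇒All¬)
open import Data.List.Relation.Unary.Unique.Propositional using (Unique; []; _∷_)
open import Data.List.Membership.Propositional using (_∈_)
open import Data.List.Membership.Propositional.Properties
  using (∈-allFin; ∈-map⁺; ∈-map⁻; ∈-concat⁺′; ∈-++⁻; ∈-applyUpTo⁻)
open import Data.List.Relation.Unary.Any using (here; there)
open import Data.Nat
  using (ℕ; zero; suc; _+_; _*_; _∸_; _^_; _≤_; _<_; _≤ᵇ_; z≤n; s≤s; z<s; s≤s⁻¹; NonZero; _%_
        ; ≢-nonZero; nonTrivial⇒n>1)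
open import Data.Nat.Properties
open import Algebra.Properties.CommutativeSemigroup +-commutativeSemigroup using () renaming (interchange to +-interchange)
open import Data.Nat.DivMod
  using (_/_; _mod_; %-distribˡ-+; %-distribˡ-*; m%n%n≡m%n; m<n⇒m%n≡m; [m+kn]%n≡m%n; n%n≡0; m*n/n≡m)
open import Data.Nat.Coprimality using (prime⇒coprime; coprime-Bézout)
import Data.Nat.GCD as GCD
open import Data.Nat.Primality using (Prime; prime⇒nonZero; prime⇒nonTrivial)
open import Data.Nat.Tactic.RingSolver using (solve-∀)
open import Data.Product using (Σ; _×_; _,_; proj₁; proj₂)
open import Data.Sum using (_⊎_; inj₁; inj₂)
open import Data.Vec using (Vec; []; _∷_) renaming (_++_ to _++ᵛ_)
import Data.Vec.Properties as Vecₚ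
open import Function using (_∘_)
open import Function.Bundles using (Equivalence)
open import Relation.Binary.Definitions using (tri<; tri≈; tri>)
open import Relation.Binary.PropositionalEquality
  using (_≡_; _≢_; refl; sym; trans; cong; cong₂; subst; module ≡-Reasoning)
open import Relation.Nullary using (yes; no)
open import Relation.Nullary.Decidable using (⌊_⌋)

-- Finite sums over lists

∑ : {A : Set} → List A → (A → ℕ) → ℕ
∑ []       f = 0
∑ (x ∷ xs) f = f x + ∑ xs f

module _ {A : Set} where

  foldr-+≡∑ : (xs : List A) (f : A → ℕ) → foldr (λ x r → f x + r) 0 xs ≡ ∑ xs f
  foldr-+≡∑ []       f = refl
  foldr-+≡∑ (x ∷ xs) f = cong (f x +_) (foldr-+≡∑ xs f)

  ∑-cong : (xs : List A) {f g : A → ℕ} → (∀ x → f x ≡ g x) → ∑ xs f ≡ ∑ xs g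
  ∑-cong []       f≡g = refl
  ∑-cong (x ∷ xs) f≡g = cong₂ _+_ (f≡g x) (∑-cong xs f≡g)

  ∑-cong-∈ : (xs : List A) {f g : A → ℕ} → (∀ {x} → x ∈ xs → f x ≡ g x) → ∑ xs f ≡ ∑ xs g
  ∑-cong-∈ []       f≡g = refl
  ∑-cong-∈ (x ∷ xs) f≡g = cong₂ _+_ (f≡g (here refl)) (∑-cong-∈ xs (f≡g ∘ there))

  ∑-zero : (xs : List A) → ∑ xs (λ _ → 0) ≡ 0
  ∑-zero []       = refl
  ∑-zero (x ∷ xs) = ∑-zero xs

  ∑-++ : (xs ys : List A) (f : A → ℕ) → ∑ (xs ++ ys) f ≡ ∑ xs f + ∑ ys f
  ∑-++ []       ys f = refl
  ∑-++ (x ∷ xs) ys f = trans (cong (f x +_) (∑-++ xs ys f)) (sym (+-assoc (f x) _ _))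

  ∑-+ : (xs : List A) (f g : A → ℕ) → ∑ xs (λ x → f x + g x) ≡ ∑ xs f + ∑ xs g
  ∑-+ []       f g = refl
  ∑-+ (x ∷ xs) f g = trans (cong (f x + g x +_) (∑-+ xs f g)) (+-interchange (f x) (g x) _ _)

  ∑-*ˡ : (xs : List A) (c : ℕ) (f : A → ℕ) → ∑ xs (λ x → c * f x) ≡ c * ∑ xs f
  ∑-*ˡ []       c f = sym (*-zeroʳ c)
  ∑-*ˡ (x ∷ xs) c f = trans (cong (c * f x +_) (∑-*ˡ xs c f)) (sym (*-distribˡ-+ c (f x) _))

  ∑-*ʳ : (xs : List A) (c : ℕ) (f : A → ℕ) → ∑ xs (λ x → f x * c) ≡ ∑ xs f * c
  ∑-*ʳ xs c f = trans (∑-cong xs (λ x → *-comm (f x) c)) (trans (∑-*ˡ xs c f) (*-comm c _))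

  ∑-const : (xs : List A) (c : ℕ) → ∑ xs (λ _ → c) ≡ length xs * c
  ∑-const []       c = refl
  ∑-const (x ∷ xs) c = cong (c +_) (∑-const xs c)

  ∑-if : (xs : List A) (b : Bool) (f : A → ℕ) →
         ∑ xs (λ x → if b then f x else 0) ≡ (if b then ∑ xs f else 0)
  ∑-if xs true  f = refl
  ∑-if xs false f = ∑-zero xs

  ∑≡0⇒≡0 : (xs : List A) (f : A → ℕ) → ∑ xs f ≡ 0 → ∀ {x} → x ∈ xs → f x ≡ 0
  ∑≡0⇒≡0 (y ∷ xs) f ∑≡0 (here refl) = m+n≡0⇒m≡0 (f y) ∑≡0
  ∑≡0⇒≡0 (y ∷ xs) f ∑≡0 (there x∈) = ∑≡0⇒≡0 xs f (m+n≡0⇒n≡0 (f y) ∑≡0) x∈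

  ∈⇒≤∑ : (xs : List A) (f : A → ℕ) {x : A} → x ∈ xs → f x ≤ ∑ xs f
  ∈⇒≤∑ (y ∷ xs) f (here refl) = m≤m+n (f y) _
  ∈⇒≤∑ (y ∷ xs) f (there x∈)  = ≤-trans (∈⇒≤∑ xs f x∈) (m≤n+m _ (f y))

module _ {A B : Set} where

  ∑-map : (xs : List A) (g : A → B) (f : B → ℕ) → ∑ (map g xs) f ≡ ∑ xs (f ∘ g)
  ∑-map []       g f = refl
  ∑-map (x ∷ xs) g f = cong (f (g x) +_) (∑-map xs g f)

  ∑-concatMap : (xs : List A) (g : A → List B) (f : B → ℕ) →
                ∑ (concatMap g xs) f ≡ ∑ xs (λ a → ∑ (g a) f)
  ∑-concatMap []       g f = refl
  ∑-concatMap (x ∷ xs) g f =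
    trans (∑-++ (g x) (concatMap g xs) f) (cong (∑ (g x) f +_) (∑-concatMap xs g f))

  ∑-comm : (xs : List A) (ys : List B) (f : A → B → ℕ) →
           ∑ xs (λ a → ∑ ys (f a)) ≡ ∑ ys (λ b → ∑ xs (λ a → f a b))
  ∑-comm []       ys f = sym (∑-zero ys)
  ∑-comm (x ∷ xs) ys f =
    trans (cong (∑ ys (f x) +_) (∑-comm xs ys f)) (sym (∑-+ ys (f x) (λ b → ∑ xs (λ a → f a b))))

∑-tabulate : ∀ {A : Set} {k} (g : Fin k → A) (h : A → ℕ) → ∑ (tabulate g) h ≡ ∑ (allFin k) (h ∘ g)
∑-tabulate {k = zero}  g h = refl
∑-tabulate {k = suc k} g h =
  cong (h (g fzero) +_) (trans (∑-tabulate (g ∘ fsuc) h) (sym (∑-tabulate fsuc (h ∘ g))))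

𝟙 : Bool → ℕ
𝟙 b = if b then 1 else 0

𝟙-∧ : ∀ a b → 𝟙 (a ∧ b) ≡ (if a then 𝟙 b else 0)
𝟙-∧ true  b = refl
𝟙-∧ false b = refl

𝟙-∧-if : ∀ a b c d → 𝟙 ((a ∧ b) ∧ (c ∧ d)) ≡ (if b ∧ c then 𝟙 (a ∧ d) else 0)
𝟙-∧-if true  true  true  d = refl
𝟙-∧-if true  true  false d = refl
𝟙-∧-if true  false c     d = refl
𝟙-∧-if false true  true  d = refl
𝟙-∧-if false true  false d = refl
𝟙-∧-if false false c     d = refl

false≢true : false ≢ true
false≢true ()

∧-true : ∀ {a b : Bool} → (a ∧ b) ≡ true → (a ≡ true) × (b ≡ true)
∧-true {true} {true} _ = refl , refl

module _ {A : Set} (f : A → Bool) where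

  any-∈ : ∀ {xs x} → x ∈ xs → f x ≡ true → any f xs ≡ true
  any-∈ {y ∷ xs} (here refl) fx rewrite fx = refl
  any-∈ {y ∷ xs} (there x∈) fx with f y
  ... | true  = refl
  ... | false = any-∈ x∈ fx

  any-witness : ∀ xs → any f xs ≡ true → Σ A (λ x → x ∈ xs × f x ≡ true)
  any-witness (y ∷ xs) any≡ with f y in fy
  ... | true  = y , here refl , fy
  ... | false with any-witness xs any≡
  ... | x , x∈ , fx = x , there x∈ , fx

  any-false : ∀ xs → any f xs ≡ false → ∀ {x} → x ∈ xs → f x ≡ false
  any-false xs any≡ {x} x∈ with f x in fx
  ... | false = refl
  ... | true  = trans (sym (any-∈ x∈ fx)) any≡

  all-∈ : ∀ xs → all f xs ≡ true → ∀ {x} → x ∈ xs → f x ≡ true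
  all-∈ (y ∷ xs) all≡ (here refl) = proj₁ (∧-true all≡)
  all-∈ (y ∷ xs) all≡ (there x∈)  = all-∈ xs (proj₂ (∧-true {f y} all≡)) x∈

  all-intro : ∀ xs → (∀ {x} → x ∈ xs → f x ≡ true) → all f xs ≡ true
  all-intro []       h = refl
  all-intro (y ∷ xs) h = cong₂ _∧_ (h (here refl)) (all-intro xs (h ∘ there))

  all-cong-∈ : ∀ xs {g : A → Bool} → (∀ {x} → x ∈ xs → f x ≡ g x) → all f xs ≡ all g xs
  all-cong-∈ []       _   = refl
  all-cong-∈ (y ∷ xs) f≡g = cong₂ _∧_ (f≡g (here refl)) (all-cong-∈ xs (f≡g ∘ there))

  all-counterexample : ∀ xs → all f xs ≡ false → Σ A (λ x → x ∈ xs × f x ≡ false)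
  all-counterexample (y ∷ xs) all≡ with f y in fy
  ... | false = y , here refl , fy
  ... | true with all-counterexample xs all≡
  ... | x , x∈ , fx = x , there x∈ , fx

module _ (p : ℕ) (pr : Prime p) where

  instance
    p≢0 : NonZero p
    p≢0 = prime⇒nonZero pr

  open LinAlg p

  1<p : 1 < p
  1<p = nonTrivial⇒n>1 p {{prime⇒nonTrivial pr}}

  -- The field F_p

  toℕ-mod : ∀ m → toℕ (m mod p) ≡ m % p
  toℕ-mod m = Finₚ.toℕ-fromℕ< _

  mod-cong : ∀ {m n} → m % p ≡ n % p → m mod p ≡ n mod p
  mod-cong {m} {n} eq = Finₚ.toℕ-injective (trans (toℕ-mod m) (trans eq (sym (toℕ-mod n))))

  toℕ-mod-toℕ : ∀ (a : F) → toℕ a mod p ≡ a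
  toℕ-mod-toℕ a = Finₚ.toℕ-injective (trans (toℕ-mod _) (m<n⇒m%n≡m (Finₚ.toℕ<n a)))

  [m%p+n]%p≡[m+n]%p : ∀ m n → (m % p + n) % p ≡ (m + n) % p
  [m%p+n]%p≡[m+n]%p m n = begin
    (m % p + n) % p           ≡⟨ %-distribˡ-+ (m % p) n p ⟩
    (m % p % p + n % p) % p   ≡⟨ cong (λ z → (z + n % p) % p) (m%n%n≡m%n m p) ⟩
    (m % p + n % p) % p       ≡⟨ sym (%-distribˡ-+ m n p) ⟩
    (m + n) % p               ∎
    where open ≡-Reasoning

  [m+n%p]%p≡[m+n]%p : ∀ m n → (m + n % p) % p ≡ (m + n) % p
  [m+n%p]%p≡[m+n]%p m n =
    trans (cong (_% p) (+-comm m _)) (trans ([m%p+n]%p≡[m+n]%p n m) (cong (_% p) (+-comm n m)))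

  [m%p*n]%p≡[m*n]%p : ∀ m n → (m % p * n) % p ≡ (m * n) % p
  [m%p*n]%p≡[m*n]%p m n = begin
    (m % p * n) % p           ≡⟨ %-distribˡ-* (m % p) n p ⟩
    (m % p % p * (n % p)) % p ≡⟨ cong (λ z → (z * (n % p)) % p) (m%n%n≡m%n m p) ⟩
    (m % p * (n % p)) % p     ≡⟨ sym (%-distribˡ-* m n p) ⟩
    (m * n) % p               ∎
    where open ≡-Reasoning

  [m*n%p]%p≡[m*n]%p : ∀ m n → (m * (n % p)) % p ≡ (m * n) % p
  [m*n%p]%p≡[m*n]%p m n =
    trans (cong (_% p) (*-comm m _)) (trans ([m%p*n]%p≡[m*n]%p n m) (cong (_% p) (*-comm n m)))

  1F -1F : F
  1F  = 1 mod p
  -1F = (p ∸ 1) mod p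

  toℕ-0F : toℕ 0F ≡ 0
  toℕ-0F = trans (toℕ-mod 0) (m<n⇒m%n≡m (<-trans z<s 1<p))

  toℕ-1F : toℕ 1F ≡ 1
  toℕ-1F = trans (toℕ-mod 1) (m<n⇒m%n≡m 1<p)

  +F-comm : ∀ a b → a +F b ≡ b +F a
  +F-comm a b = cong (_mod p) (+-comm (toℕ a) (toℕ b))

  +F-assoc : ∀ a b c → (a +F b) +F c ≡ a +F (b +F c)
  +F-assoc a b c = mod-cong (begin
    (toℕ (a +F b) + toℕ c) % p          ≡⟨ cong (λ z → (z + toℕ c) % p) (toℕ-mod _) ⟩
    ((toℕ a + toℕ b) % p + toℕ c) % p   ≡⟨ [m%p+n]%p≡[m+n]%p (toℕ a + toℕ b) (toℕ c) ⟩
    (toℕ a + toℕ b + toℕ c) % p         ≡⟨ cong (_% p) (+-assoc (toℕ a) _ _) ⟩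
    (toℕ a + (toℕ b + toℕ c)) % p       ≡⟨ sym ([m+n%p]%p≡[m+n]%p (toℕ a) (toℕ b + toℕ c)) ⟩
    (toℕ a + (toℕ b + toℕ c) % p) % p   ≡⟨ cong (λ z → (toℕ a + z) % p) (sym (toℕ-mod _)) ⟩
    (toℕ a + toℕ (b +F c)) % p          ∎)
    where open ≡-Reasoning

  +F-identityˡ : ∀ a → 0F +F a ≡ a
  +F-identityˡ a = trans (cong (λ z → (z + toℕ a) mod p) toℕ-0F) (toℕ-mod-toℕ a)

  +F-identityʳ : ∀ a → a +F 0F ≡ a
  +F-identityʳ a = trans (+F-comm a 0F) (+F-identityˡ a)

  *F-comm : ∀ a b → a *F b ≡ b *F a
  *F-comm a b = cong (_mod p) (*-comm (toℕ a) (toℕ b))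

  *F-assoc : ∀ a b c → (a *F b) *F c ≡ a *F (b *F c)
  *F-assoc a b c = mod-cong (begin
    (toℕ (a *F b) * toℕ c) % p          ≡⟨ cong (λ z → (z * toℕ c) % p) (toℕ-mod _) ⟩
    ((toℕ a * toℕ b) % p * toℕ c) % p   ≡⟨ [m%p*n]%p≡[m*n]%p (toℕ a * toℕ b) (toℕ c) ⟩
    (toℕ a * toℕ b * toℕ c) % p         ≡⟨ cong (_% p) (*-assoc (toℕ a) _ _) ⟩
    (toℕ a * (toℕ b * toℕ c)) % p       ≡⟨ sym ([m*n%p]%p≡[m*n]%p (toℕ a) (toℕ b * toℕ c)) ⟩
    (toℕ a * ((toℕ b * toℕ c) % p)) % p ≡⟨ cong (λ z → (toℕ a * z) % p) (sym (toℕ-mod _)) ⟩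
    (toℕ a * toℕ (b *F c)) % p          ∎)
    where open ≡-Reasoning

  *F-identityˡ : ∀ a → 1F *F a ≡ a
  *F-identityˡ a =
    trans (cong (λ z → (z * toℕ a) mod p) toℕ-1F)
          (trans (cong (_mod p) (+-identityʳ (toℕ a))) (toℕ-mod-toℕ a))

  *F-zeroˡ : ∀ a → 0F *F a ≡ 0F
  *F-zeroˡ a = cong (λ z → (z * toℕ a) mod p) toℕ-0F

  *F-zeroʳ : ∀ a → a *F 0F ≡ 0F
  *F-zeroʳ a = trans (*F-comm a 0F) (*F-zeroˡ a)

  *F-distribˡ-+F : ∀ a b c → a *F (b +F c) ≡ (a *F b) +F (a *F c)
  *F-distribˡ-+F a b c = mod-cong (begin
    (toℕ a * toℕ (b +F c)) % p                  ≡⟨ cong (λ z → (toℕ a * z) % p) (toℕ-mod _) ⟩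
    (toℕ a * ((toℕ b + toℕ c) % p)) % p         ≡⟨ [m*n%p]%p≡[m*n]%p (toℕ a) _ ⟩
    (toℕ a * (toℕ b + toℕ c)) % p               ≡⟨ cong (_% p) (*-distribˡ-+ (toℕ a) (toℕ b) (toℕ c)) ⟩
    (toℕ a * toℕ b + toℕ a * toℕ c) % p         ≡⟨ sym ([m%p+n]%p≡[m+n]%p (toℕ a * toℕ b) _) ⟩
    ((toℕ a * toℕ b) % p + toℕ a * toℕ c) % p   ≡⟨ sym ([m+n%p]%p≡[m+n]%p ((toℕ a * toℕ b) % p) _) ⟩
    ((toℕ a * toℕ b) % p + (toℕ a * toℕ c) % p) % p
      ≡⟨ cong₂ (λ z w → (z + w) % p) (sym (toℕ-mod _)) (sym (toℕ-mod _)) ⟩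
    (toℕ (a *F b) + toℕ (a *F c)) % p           ∎)
    where open ≡-Reasoning

  *F-distribʳ-+F : ∀ a b c → (a +F b) *F c ≡ (a *F c) +F (b *F c)
  *F-distribʳ-+F a b c =
    trans (*F-comm _ c) (trans (*F-distribˡ-+F c a b) (cong₂ _+F_ (*F-comm c a) (*F-comm c b)))

  1F+-1F≡0F : 1F +F -1F ≡ 0F
  1F+-1F≡0F = mod-cong (begin
    (toℕ 1F + toℕ -1F) % p   ≡⟨ cong₂ (λ z w → (z + w) % p) toℕ-1F (toℕ-mod _) ⟩
    (1 + (p ∸ 1) % p) % p    ≡⟨ [m+n%p]%p≡[m+n]%p 1 (p ∸ 1) ⟩
    (1 + (p ∸ 1)) % p        ≡⟨ cong (_% p) (m+[n∸m]≡n (<-trans z<s 1<p)) ⟩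
    p % p                    ≡⟨ n%n≡0 p ⟩
    0                        ≡⟨ sym (m<n⇒m%n≡m (<-trans z<s 1<p)) ⟩
    0 % p                    ∎)
    where open ≡-Reasoning

  1F≢0F : 1F ≢ 0F
  1F≢0F eq with trans (sym toℕ-1F) (trans (cong toℕ eq) toℕ-0F)
  ... | ()

  -1F≢0F : -1F ≢ 0F
  -1F≢0F eq = 1F≢0F (trans (sym (+F-identityʳ 1F)) (trans (cong (1F +F_) (sym eq)) 1F+-1F≡0F))

  -- Inverses come from a Bézout identity y·a − x·p = ±1; in the − case the inverse is −y.
  *F-inverse : ∀ a → a ≢ 0F → Σ F (λ b → b *F a ≡ 1F)
  *F-inverse a a≢0 = fromBézout (coprime-Bézout (prime⇒coprime pr {{toℕa≢0}} (Finₚ.toℕ<n a)))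
    where
    toℕa≢0 : NonZero (toℕ a)
    toℕa≢0 = ≢-nonZero (λ eq → a≢0 (Finₚ.toℕ-injective (trans eq (sym toℕ-0F))))

    q = p ∸ 1

    p≡1+q : p ≡ 1 + q
    p≡1+q = sym (m+[n∸m]≡n (<-trans z<s 1<p))

    fromBézout : GCD.Bézout.Identity 1 p (toℕ a) → Σ F (λ b → b *F a ≡ 1F)
    fromBézout (GCD.Bézout.-+ x y eq) = (y mod p) , mod-cong (begin
      (toℕ (y mod p) * toℕ a) % p   ≡⟨ cong (λ z → (z * toℕ a) % p) (toℕ-mod y) ⟩
      (y % p * toℕ a) % p           ≡⟨ [m%p*n]%p≡[m*n]%p y (toℕ a) ⟩
      (y * toℕ a) % p               ≡⟨ cong (_% p) (sym eq) ⟩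
      (1 + x * p) % p               ≡⟨ [m+kn]%n≡m%n 1 x p ⟩
      1 % p                         ∎)
      where open ≡-Reasoning
    fromBézout (GCD.Bézout.+- x y eq) = ((q * y) mod p) , mod-cong (begin
      (toℕ ((q * y) mod p) * toℕ a) % p   ≡⟨ cong (λ z → (z * toℕ a) % p) (toℕ-mod _) ⟩
      ((q * y) % p * toℕ a) % p           ≡⟨ [m%p*n]%p≡[m*n]%p (q * y) (toℕ a) ⟩
      (q * y * toℕ a) % p                 ≡⟨ sym ([m+kn]%n≡m%n _ 1 p) ⟩
      (q * y * toℕ a + 1 * p) % p         ≡⟨ cong (_% p) shifted ⟩
      (1 + q * x * p) % p                 ≡⟨ [m+kn]%n≡m%n 1 (q * x) p ⟩
      1 % p                               ∎)
      where
      open ≡-Reasoning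
      rearrange : ∀ q y t x → 1 + y * t ≡ x * (1 + q) → q * y * t + 1 * (1 + q) ≡ 1 + q * x * (1 + q)
      rearrange q y t x e = begin
        q * y * t + 1 * (1 + q)   ≡⟨ solve q y t ⟩
        1 + q * (1 + y * t)       ≡⟨ cong (λ z → 1 + q * z) e ⟩
        1 + q * (x * (1 + q))     ≡⟨ cong (1 +_) (sym (*-assoc q x _)) ⟩
        1 + q * x * (1 + q)       ∎
        where
        solve : ∀ q y t → q * y * t + 1 * (1 + q) ≡ 1 + q * (1 + y * t)
        solve = solve-∀
      shifted : q * y * toℕ a + 1 * p ≡ 1 + q * x * p
      shifted = subst (λ P → q * y * toℕ a + 1 * P ≡ 1 + q * x * P) (sym p≡1+q)
                      (rearrange q y (toℕ a) x (subst (λ P → 1 + y * toℕ a ≡ x * P) p≡1+q eq))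

  -- The vector space F_p^m

  -V_ : ∀ {m} → V m → V m
  -V v = -1F ·V v

  +V-comm : ∀ {m} (u v : V m) → u +V v ≡ v +V u
  +V-comm []      []      = refl
  +V-comm (a ∷ u) (b ∷ v) = cong₂ _∷_ (+F-comm a b) (+V-comm u v)

  +V-assoc : ∀ {m} (u v w : V m) → (u +V v) +V w ≡ u +V (v +V w)
  +V-assoc []      []      []      = refl
  +V-assoc (a ∷ u) (b ∷ v) (c ∷ w) = cong₂ _∷_ (+F-assoc a b c) (+V-assoc u v w)

  +V-identityˡ : ∀ {m} (v : V m) → 0V +V v ≡ v
  +V-identityˡ []      = refl
  +V-identityˡ (a ∷ v) = cong₂ _∷_ (+F-identityˡ a) (+V-identityˡ v)

  +V-identityʳ : ∀ {m} (v : V m) → v +V 0V ≡ v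
  +V-identityʳ v = trans (+V-comm v 0V) (+V-identityˡ v)

  +V-interchange : ∀ {m} (a b c d : V m) → (a +V b) +V (c +V d) ≡ (a +V c) +V (b +V d)
  +V-interchange a b c d = begin
    (a +V b) +V (c +V d)   ≡⟨ +V-assoc a b _ ⟩
    a +V (b +V (c +V d))   ≡⟨ cong (a +V_) (sym (+V-assoc b c d)) ⟩
    a +V ((b +V c) +V d)   ≡⟨ cong (λ z → a +V (z +V d)) (+V-comm b c) ⟩
    a +V ((c +V b) +V d)   ≡⟨ cong (a +V_) (+V-assoc c b d) ⟩
    a +V (c +V (b +V d))   ≡⟨ sym (+V-assoc a c _) ⟩
    (a +V c) +V (b +V d)   ∎
    where open ≡-Reasoning

  ·V-distribˡ-+V : ∀ {m} a (u v : V m) → a ·V (u +V v) ≡ (a ·V u) +V (a ·V v)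
  ·V-distribˡ-+V a []      []      = refl
  ·V-distribˡ-+V a (b ∷ u) (c ∷ v) = cong₂ _∷_ (*F-distribˡ-+F a b c) (·V-distribˡ-+V a u v)

  ·V-distribʳ-+F : ∀ {m} a b (v : V m) → (a +F b) ·V v ≡ (a ·V v) +V (b ·V v)
  ·V-distribʳ-+F a b []      = refl
  ·V-distribʳ-+F a b (c ∷ v) = cong₂ _∷_ (*F-distribʳ-+F a b c) (·V-distribʳ-+F a b v)

  ·V-assoc : ∀ {m} a b (v : V m) → (a *F b) ·V v ≡ a ·V (b ·V v)
  ·V-assoc a b []      = refl
  ·V-assoc a b (c ∷ v) = cong₂ _∷_ (*F-assoc a b c) (·V-assoc a b v)

  ·V-zeroˡ : ∀ {m} (v : V m) → 0F ·V v ≡ 0V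
  ·V-zeroˡ []      = refl
  ·V-zeroˡ (c ∷ v) = cong₂ _∷_ (*F-zeroˡ c) (·V-zeroˡ v)

  ·V-zeroʳ : ∀ {m} a → a ·V (0V {m}) ≡ 0V
  ·V-zeroʳ {zero}  a = refl
  ·V-zeroʳ {suc m} a = cong₂ _∷_ (*F-zeroʳ a) (·V-zeroʳ a)

  ·V-identityˡ : ∀ {m} (v : V m) → 1F ·V v ≡ v
  ·V-identityˡ []      = refl
  ·V-identityˡ (c ∷ v) = cong₂ _∷_ (*F-identityˡ c) (·V-identityˡ v)

  +V-inverseʳ : ∀ {m} (v : V m) → v +V (-V v) ≡ 0V
  +V-inverseʳ v = begin
    v +V (-1F ·V v)            ≡⟨ cong (_+V (-1F ·V v)) (sym (·V-identityˡ v)) ⟩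
    (1F ·V v) +V (-1F ·V v)    ≡⟨ sym (·V-distribʳ-+F 1F -1F v) ⟩
    (1F +F -1F) ·V v           ≡⟨ cong (_·V v) 1F+-1F≡0F ⟩
    0F ·V v                    ≡⟨ ·V-zeroˡ v ⟩
    0V                         ∎
    where open ≡-Reasoning

  +V≡0V⇒≡-V : ∀ {m} (u w : V m) → u +V w ≡ 0V → u ≡ -V w
  +V≡0V⇒≡-V u w eq = begin
    u                      ≡⟨ sym (+V-identityʳ u) ⟩
    u +V 0V                ≡⟨ cong (u +V_) (sym (+V-inverseʳ w)) ⟩
    u +V (w +V (-V w))     ≡⟨ sym (+V-assoc u w _) ⟩
    (u +V w) +V (-V w)     ≡⟨ cong (_+V (-V w)) eq ⟩
    0V +V (-V w)           ≡⟨ +V-identityˡ _ ⟩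
    -V w                   ∎
    where open ≡-Reasoning

  -V-involutive : ∀ {m} (v : V m) → -V (-V v) ≡ v
  -V-involutive v = sym (+V≡0V⇒≡-V v (-V v) (+V-inverseʳ v))

  +V-V≡0V⇒≡ : ∀ {m} (u v : V m) → u +V (-V v) ≡ 0V → u ≡ v
  +V-V≡0V⇒≡ u v eq = trans (+V≡0V⇒≡-V u (-V v) eq) (-V-involutive v)

  =V-refl : ∀ {m} (u : V m) → (u =V u) ≡ true
  =V-refl u with Vecₚ.≡-dec Finₚ._≟_ u u
  ... | yes _ = refl
  ... | no u≢u = ⊥-elim (u≢u refl)

  =V⇒≡ : ∀ {m} {u v : V m} → (u =V v) ≡ true → u ≡ v
  =V⇒≡ {u = u} {v} eq with Vecₚ.≡-dec Finₚ._≟_ u v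
  ... | yes u≡v = u≡v

  ≡⇒=V : ∀ {m} {u v : V m} → u ≡ v → (u =V v) ≡ true
  ≡⇒=V {u = u} refl = =V-refl u

  ≢⇒=V-false : ∀ {m} {u v : V m} → u ≢ v → (u =V v) ≡ false
  ≢⇒=V-false {u = u} {v} u≢v with Vecₚ.≡-dec Finₚ._≟_ u v
  ... | yes u≡v = ⊥-elim (u≢v u≡v)
  ... | no _    = refl

  =V-sym : ∀ {m} (u v : V m) → (u =V v) ≡ (v =V u)
  =V-sym u v with Vecₚ.≡-dec Finₚ._≟_ u v
  ... | yes refl = sym (=V-refl u)
  ... | no u≢v   = sym (≢⇒=V-false (u≢v ∘ sym))

  =V-reflects : ∀ {m} (u v : V m) → (u ≡ v × (u =V v) ≡ true) ⊎ (u ≢ v × (u =V v) ≡ false)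
  =V-reflects u v with Vecₚ.≡-dec Finₚ._≟_ u v
  ... | yes u≡v = inj₁ (u≡v , refl)
  ... | no u≢v  = inj₂ (u≢v , refl)

  _=F_ : F → F → Bool
  a =F b = ⌊ a Finₚ.≟ b ⌋

  =F-reflects : (a b : F) → (a ≡ b × (a =F b) ≡ true) ⊎ (a ≢ b × (a =F b) ≡ false)
  =F-reflects a b with a Finₚ.≟ b
  ... | yes a≡b = inj₁ (a≡b , refl)
  ... | no a≢b  = inj₂ (a≢b , refl)

  =V-∷ : ∀ {m} a b (u v : V m) → ((a ∷ u) =V (b ∷ v)) ≡ ((a =F b) ∧ (u =V v))
  =V-∷ a b u v with =F-reflects a b | =V-reflects u v
  ... | inj₁ (refl , a=b) | inj₁ (refl , u=v) = trans (=V-refl (a ∷ u)) (sym (cong₂ _∧_ a=b u=v))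
  ... | inj₁ (refl , a=b) | inj₂ (u≢v , u=v)  =
    trans (≢⇒=V-false (u≢v ∘ Vecₚ.∷-injectiveʳ)) (sym (cong₂ _∧_ a=b u=v))
  ... | inj₂ (a≢b , a=b)  | _                 =
    trans (≢⇒=V-false (a≢b ∘ Vecₚ.∷-injectiveˡ)) (sym (cong (_∧ (u =V v)) a=b))

  ∈⇒∈ᵇ : ∀ {m} {x : V m} {S : List (V m)} → x ∈ S → (x ∈ᵇ S) ≡ true
  ∈⇒∈ᵇ {x = x} x∈ = any-∈ (x =V_) x∈ (=V-refl x)

  ∈ᵇ⇒∈ : ∀ {m} {x : V m} (S : List (V m)) → (x ∈ᵇ S) ≡ true → x ∈ S
  ∈ᵇ⇒∈ {x = x} S x∈ᵇ with any-witness (x =V_) S x∈ᵇ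
  ... | y , y∈ , x=y = subst (_∈ S) (sym (=V⇒≡ x=y)) y∈

  ∈-allVecs : ∀ m (v : V m) → v ∈ allVecs m
  ∈-allVecs zero    []      = here refl
  ∈-allVecs (suc m) (a ∷ v) =
    ∈-concat⁺′ (∈-map⁺ (a ∷_) (∈-allVecs m v)) (∈-map⁺ (λ a → map (a ∷_) (allVecs m)) (∈-allFin a))

  ∑-allVecs-suc : ∀ m (f : V (suc m) → ℕ) →
                  ∑ (allVecs (suc m)) f ≡ ∑ (allFin p) (λ a → ∑ (allVecs m) (λ v → f (a ∷ v)))
  ∑-allVecs-suc m f =
    trans (∑-concatMap (allFin p) (λ a → map (a ∷_) (allVecs m)) f)
          (∑-cong (allFin p) (λ a → ∑-map (allVecs m) (a ∷_) f))

  ∑-allFin-δ : ∀ {k} (b : Fin k) (h : Fin k → ℕ) →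
               ∑ (allFin k) (λ a → if ⌊ a Finₚ.≟ b ⌋ then h a else 0) ≡ h b
  ∑-allFin-δ {suc k} fzero h =
    trans (cong (h fzero +_) (trans (∑-tabulate fsuc (λ a → if ⌊ a Finₚ.≟ fzero ⌋ then h a else 0))
                                    (∑-zero (allFin k))))
          (+-identityʳ _)
  ∑-allFin-δ {suc k} (fsuc b) h =
    trans (∑-tabulate fsuc (λ a → if ⌊ a Finₚ.≟ fsuc b ⌋ then h a else 0))
          (trans (∑-cong (allFin k) shift) (∑-allFin-δ b (h ∘ fsuc)))
    where
    shift : ∀ a → (if ⌊ fsuc a Finₚ.≟ fsuc b ⌋ then h (fsuc a) else 0)
                ≡ (if ⌊ a Finₚ.≟ b ⌋ then h (fsuc a) else 0)
    shift a with a Finₚ.≟ b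
    ... | yes refl = refl
    ... | no _     = refl

  ∑-allVecs-δ : ∀ m (x : V m) (g : V m → ℕ) → ∑ (allVecs m) (λ v → if v =V x then g v else 0) ≡ g x
  ∑-allVecs-δ zero    []       g = +-identityʳ _
  ∑-allVecs-δ (suc m) (x₀ ∷ x) g = begin
    ∑ (allVecs (suc m)) (λ v → if v =V (x₀ ∷ x) then g v else 0)
      ≡⟨ ∑-allVecs-suc m _ ⟩
    ∑ (allFin p) (λ a → ∑ (allVecs m) (λ v → if (a ∷ v) =V (x₀ ∷ x) then g (a ∷ v) else 0))
      ≡⟨ ∑-cong (allFin p) (λ a → trans (∑-cong (allVecs m) (split a)) (∑-if (allVecs m) (a =F x₀) _)) ⟩
    ∑ (allFin p) (λ a → if a =F x₀ then ∑ (allVecs m) (λ v → if v =V x then g (a ∷ v) else 0) else 0)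
      ≡⟨ ∑-cong (allFin p) (λ a → cong (λ z → if a =F x₀ then z else 0) (∑-allVecs-δ m x (g ∘ (a ∷_)))) ⟩
    ∑ (allFin p) (λ a → if a =F x₀ then g (a ∷ x) else 0)
      ≡⟨ ∑-allFin-δ x₀ (λ a → g (a ∷ x)) ⟩
    g (x₀ ∷ x) ∎
    where
    open ≡-Reasoning
    split : ∀ a v → (if (a ∷ v) =V (x₀ ∷ x) then g (a ∷ v) else 0)
                  ≡ (if a =F x₀ then (if v =V x then g (a ∷ v) else 0) else 0)
    split a v rewrite =V-∷ a x₀ v x with a =F x₀
    ... | true  = refl
    ... | false = refl

  ∑-allVecs-1 : ∀ m → ∑ (allVecs m) (λ _ → 1) ≡ p ^ m
  ∑-allVecs-1 zero    = refl
  ∑-allVecs-1 (suc m) = begin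
    ∑ (allVecs (suc m)) (λ _ → 1)                  ≡⟨ ∑-allVecs-suc m _ ⟩
    ∑ (allFin p) (λ _ → ∑ (allVecs m) (λ _ → 1))  ≡⟨ ∑-const (allFin p) _ ⟩
    length (allFin p) * ∑ (allVecs m) (λ _ → 1)   ≡⟨ cong₂ _*_ (Listₚ.length-tabulate {n = p} (λ i → i)) (∑-allVecs-1 m) ⟩
    p * p ^ m                                      ∎
    where open ≡-Reasoning

  -- Linear combinations, spans and independence

  module _ {n : ℕ} where

    lincomb-0V : ∀ {d} (b : Vec (V n) d) → lincomb 0V b ≡ 0V
    lincomb-0V []      = refl
    lincomb-0V (x ∷ b) = trans (cong₂ _+V_ (·V-zeroˡ x) (lincomb-0V b)) (+V-identityˡ 0V)

    lincomb-+V : ∀ {d} (c c′ : V d) (b : Vec (V n) d) → lincomb (c +V c′) b ≡ lincomb c b +V lincomb c′ b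
    lincomb-+V []      []        []      = sym (+V-identityˡ 0V)
    lincomb-+V (a ∷ c) (a′ ∷ c′) (x ∷ b) =
      trans (cong₂ _+V_ (·V-distribʳ-+F a a′ x) (lincomb-+V c c′ b)) (+V-interchange _ _ _ _)

    lincomb-·V : ∀ {d} a (c : V d) (b : Vec (V n) d) → lincomb (a ·V c) b ≡ a ·V lincomb c b
    lincomb-·V a []       []      = sym (·V-zeroʳ a)
    lincomb-·V a (a₀ ∷ c) (x ∷ b) =
      trans (cong₂ _+V_ (·V-assoc a a₀ x) (lincomb-·V a c b)) (sym (·V-distribˡ-+V a _ _))

    InSpan : ∀ {d} → Vec (V n) d → V n → Set
    InSpan {d} b x = Σ (V d) (λ c → lincomb c b ≡ x)

    inSpan : ∀ {d} → Vec (V n) d → V n → Bool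
    inSpan {d} b x = any (λ c → lincomb c b =V x) (allVecs d)

    InSpan⇒inSpan : ∀ {d} (b : Vec (V n) d) {x} → InSpan b x → inSpan b x ≡ true
    InSpan⇒inSpan {d} b {x} (c , eq) = any-∈ (λ c → lincomb c b =V x) (∈-allVecs d c) (≡⇒=V eq)

    inSpan⇒InSpan : ∀ {d} (b : Vec (V n) d) {x} → inSpan b x ≡ true → InSpan b x
    inSpan⇒InSpan {d} b {x} x∈ with any-witness (λ c → lincomb c b =V x) (allVecs d) x∈
    ... | c , _ , eq = c , =V⇒≡ eq

    Independent : ∀ {d} → Vec (V n) d → Set
    Independent {d} b = ∀ c → lincomb c b ≡ 0V → c ≡ 0V

    linIndep⇒Independent : ∀ {d} (b : Vec (V n) d) → linIndep b ≡ true → Independent b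
    linIndep⇒Independent {d} b indep c c·b≡0 with all-∈ _ (allVecs d) indep (∈-allVecs d c)
    ... | implication rewrite ≡⇒=V c·b≡0 = =V⇒≡ implication

    Independent⇒linIndep : ∀ {d} (b : Vec (V n) d) → Independent b → linIndep b ≡ true
    Independent⇒linIndep {d} b indep = all-intro _ (allVecs d) implication
      where
      implication : ∀ {c} → c ∈ allVecs d → (if lincomb c b =V 0V then c =V 0V else true) ≡ true
      implication {c} _ with =V-reflects (lincomb c b) 0V
      ... | inj₁ (c·b≡0 , eq) rewrite eq = ≡⇒=V (indep c c·b≡0)
      ... | inj₂ (_ , eq)     rewrite eq = refl

    lincomb-injective : ∀ {d} (b : Vec (V n) d) → Independent b → ∀ c c′ → lincomb c b ≡ lincomb c′ b → c ≡ c′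
    lincomb-injective b indep c c′ eq = +V-V≡0V⇒≡ c c′ (indep _ (begin
      lincomb (c +V (-V c′)) b                 ≡⟨ lincomb-+V c (-V c′) b ⟩
      lincomb c b +V lincomb (-1F ·V c′) b     ≡⟨ cong (lincomb c b +V_) (lincomb-·V -1F c′ b) ⟩
      lincomb c b +V (-V lincomb c′ b)         ≡⟨ cong (λ z → lincomb c b +V (-V z)) (sym eq) ⟩
      lincomb c b +V (-V lincomb c b)          ≡⟨ +V-inverseʳ _ ⟩
      0V                                       ∎))
      where open ≡-Reasoning

    Independent-tail : ∀ {d} (x : V n) (b : Vec (V n) d) → Independent (x ∷ b) → Independent b
    Independent-tail x b indep c c·b≡0 =
      Vecₚ.∷-injectiveʳ (indep (0F ∷ c) (trans (cong₂ _+V_ (·V-zeroˡ x) c·b≡0) (+V-identityˡ 0V)))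

    Independent⇒∉span : ∀ {d} (x : V n) (b : Vec (V n) d) → Independent (x ∷ b) → InSpan b x → ⊥
    Independent⇒∉span x b indep (c , c·b≡x) = -1F≢0F (Vecₚ.∷-injectiveˡ (indep (-1F ∷ c) (begin
      (-1F ·V x) +V lincomb c b   ≡⟨ cong ((-1F ·V x) +V_) c·b≡x ⟩
      (-V x) +V x                 ≡⟨ +V-comm _ x ⟩
      x +V (-V x)                 ≡⟨ +V-inverseʳ x ⟩
      0V                          ∎)))
      where open ≡-Reasoning

    -- A relation a·x + c·b = 0 with a ≠ 0 would put x = (a⁻¹ · −1) · (c·b) in the span of b.
    Independent-∷ : ∀ {d} (x : V n) (b : Vec (V n) d) → Independent b → (InSpan b x → ⊥) → Independent (x ∷ b)
    Independent-∷ x b indep x∉ (a ∷ c) rel with =F-reflects a 0F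
    ... | inj₁ (refl , _) =
      cong (0F ∷_) (indep c (trans (sym (+V-identityˡ _)) (trans (cong (_+V lincomb c b) (sym (·V-zeroˡ x))) rel)))
    ... | inj₂ (a≢0 , _) with *F-inverse a a≢0
    ... | a⁻¹ , a⁻¹a≡1 = ⊥-elim (x∉ (((a⁻¹ *F -1F) ·V c) , (begin
      lincomb ((a⁻¹ *F -1F) ·V c) b   ≡⟨ lincomb-·V (a⁻¹ *F -1F) c b ⟩
      (a⁻¹ *F -1F) ·V lincomb c b     ≡⟨ ·V-assoc a⁻¹ -1F _ ⟩
      a⁻¹ ·V (-V lincomb c b)         ≡⟨ cong (a⁻¹ ·V_) (sym (+V≡0V⇒≡-V (a ·V x) (lincomb c b) rel)) ⟩
      a⁻¹ ·V (a ·V x)                 ≡⟨ sym (·V-assoc a⁻¹ a x) ⟩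
      (a⁻¹ *F a) ·V x                 ≡⟨ cong (_·V x) a⁻¹a≡1 ⟩
      1F ·V x                         ≡⟨ ·V-identityˡ x ⟩
      x                               ∎)))
      where open ≡-Reasoning

    linIndep-∷ : ∀ {d} (x : V n) (b : Vec (V n) d) → linIndep (x ∷ b) ≡ (linIndep b ∧ not (inSpan b x))
    linIndep-∷ x b with linIndep b in indep | inSpan b x in x∈
    ... | false | _ = Boolₚ.¬-not λ indep′ →
      false≢true (trans (sym indep) (Independent⇒linIndep b (Independent-tail x b (linIndep⇒Independent _ indep′))))
    ... | true | true = Boolₚ.¬-not λ indep′ →
      Independent⇒∉span x b (linIndep⇒Independent _ indep′) (inSpan⇒InSpan b x∈)
    ... | true | false = Independent⇒linIndep _ (Independent-∷ x b (linIndep⇒Independent b indep)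
      λ x∈′ → false≢true (trans (sym x∈) (InSpan⇒inSpan b x∈′)))

  -- Linear predicates and counting vectors

  module _ {n : ℕ} where

    _⊆ᵇ_ : (Q P : V n → Bool) → Set
    Q ⊆ᵇ P = ∀ v → Q v ≡ true → P v ≡ true

    record IsLinear (P : V n → Bool) : Set where
      field
        0V∈       : P 0V ≡ true
        +V-closed : ∀ x y → P x ≡ true → P y ≡ true → P (x +V y) ≡ true
        ·V-closed : ∀ a x → P x ≡ true → P (a ·V x) ≡ true

    allᵛ : (V n → Bool) → ∀ {d} → Vec (V n) d → Bool
    allᵛ P []      = true
    allᵛ P (x ∷ b) = P x ∧ allᵛ P b

    allᵛ-++ : (P : V n → Bool) → ∀ {d e} (b : Vec (V n) d) (a : Vec (V n) e) →
              allᵛ P (b ++ᵛ a) ≡ (allᵛ P b ∧ allᵛ P a)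
    allᵛ-++ P []      a = refl
    allᵛ-++ P (x ∷ b) a = trans (cong (P x ∧_) (allᵛ-++ P b a)) (sym (Boolₚ.∧-assoc (P x) _ _))

    allᵛ-mono : ∀ {P Q} → P ⊆ᵇ Q → ∀ {d} (b : Vec (V n) d) → allᵛ P b ≡ true → allᵛ Q b ≡ true
    allᵛ-mono P⊆Q []      _   = refl
    allᵛ-mono P⊆Q (x ∷ b) all = cong₂ _∧_ (P⊆Q x (proj₁ (∧-true all))) (allᵛ-mono P⊆Q b (proj₂ (∧-true all)))

    allᵛ-true : ∀ {d} (b : Vec (V n) d) → allᵛ (λ _ → true) b ≡ true
    allᵛ-true []      = refl
    allᵛ-true (x ∷ b) = allᵛ-true b

    lincomb-closed : ∀ {P} → IsLinear P → ∀ {d} (b : Vec (V n) d) → allᵛ P b ≡ true → ∀ c → P (lincomb c b) ≡ true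
    lincomb-closed lin []      _   []      = IsLinear.0V∈ lin
    lincomb-closed lin (x ∷ b) all (a ∷ c) =
      IsLinear.+V-closed lin _ _ (IsLinear.·V-closed lin a x (proj₁ (∧-true all)))
                                 (lincomb-closed lin b (proj₂ (∧-true all)) c)

    span⊆ : ∀ {P} → IsLinear P → ∀ {d} (b : Vec (V n) d) → allᵛ P b ≡ true → inSpan b ⊆ᵇ P
    span⊆ lin b all x x∈ with inSpan⇒InSpan b x∈
    ... | c , refl = lincomb-closed lin b all c

    inSpan-isLinear : ∀ {d} (b : Vec (V n) d) → IsLinear (inSpan b)
    inSpan-isLinear b = record
      { 0V∈       = InSpan⇒inSpan b (0V , lincomb-0V b)
      ; +V-closed = λ x y x∈ y∈ → +V-closed (inSpan⇒InSpan b x∈) (inSpan⇒InSpan b y∈)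
      ; ·V-closed = λ a x x∈ → ·V-closed a (inSpan⇒InSpan b x∈)
      }
      where
      +V-closed : ∀ {x y} → InSpan b x → InSpan b y → inSpan b (x +V y) ≡ true
      +V-closed (c , refl) (c′ , refl) = InSpan⇒inSpan b ((c +V c′) , lincomb-+V c c′ b)
      ·V-closed : ∀ a {x} → InSpan b x → inSpan b (a ·V x) ≡ true
      ·V-closed a (c , refl) = InSpan⇒inSpan b ((a ·V c) , lincomb-·V a c b)

    allᵛ-inSpan : ∀ {d} (b : Vec (V n) d) → allᵛ (inSpan b) b ≡ true
    allᵛ-inSpan []      = refl
    allᵛ-inSpan (x ∷ b) =
      cong₂ _∧_ (InSpan⇒inSpan (x ∷ b) ((1F ∷ 0V) , trans (cong₂ _+V_ (·V-identityˡ x) (lincomb-0V b)) (+V-identityʳ x)))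
                (allᵛ-mono shift b (allᵛ-inSpan b))
      where
      shift : inSpan b ⊆ᵇ inSpan (x ∷ b)
      shift v v∈ with inSpan⇒InSpan b v∈
      ... | c , refl = InSpan⇒inSpan (x ∷ b) ((0F ∷ c) , trans (cong (_+V lincomb c b) (·V-zeroˡ x)) (+V-identityˡ _))

    # : (V n → Bool) → ℕ
    # P = ∑ (allVecs n) (𝟙 ∘ P)

    #-true : # (λ _ → true) ≡ p ^ n
    #-true = ∑-allVecs-1 n

    ∑-representations : ∀ {d} (b : Vec (V n) d) → Independent b → ∀ x →
                        ∑ (allVecs d) (λ c → 𝟙 (lincomb c b =V x)) ≡ 𝟙 (inSpan b x)
    ∑-representations {d} b indep x with inSpan b x in x∈
    ... | false = trans (∑-cong-∈ (allVecs d) (cong 𝟙 ∘ any-false (λ c → lincomb c b =V x) (allVecs d) x∈))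
                        (∑-zero (allVecs d))
    ... | true with inSpan⇒InSpan b x∈
    ... | c₀ , refl = trans (∑-cong (allVecs d) same-coefficients) (∑-allVecs-δ d c₀ (λ _ → 1))
      where
      same-coefficients : ∀ c → 𝟙 (lincomb c b =V lincomb c₀ b) ≡ 𝟙 (c =V c₀)
      same-coefficients c with =V-reflects c c₀
      ... | inj₁ (refl , eq) = cong 𝟙 (trans (=V-refl _) (sym eq))
      ... | inj₂ (c≢c₀ , eq) = cong 𝟙 (trans (≢⇒=V-false (c≢c₀ ∘ lincomb-injective b indep c c₀)) (sym eq))

    #-inSpan : ∀ {d} (b : Vec (V n) d) → Independent b → # (inSpan b) ≡ p ^ d
    #-inSpan {d} b indep = begin
      ∑ (allVecs n) (λ x → 𝟙 (inSpan b x))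
        ≡⟨ ∑-cong (allVecs n) (sym ∘ ∑-representations b indep) ⟩
      ∑ (allVecs n) (λ x → ∑ (allVecs d) (λ c → 𝟙 (lincomb c b =V x)))
        ≡⟨ ∑-comm (allVecs n) (allVecs d) _ ⟩
      ∑ (allVecs d) (λ c → ∑ (allVecs n) (λ x → 𝟙 (lincomb c b =V x)))
        ≡⟨ ∑-cong (allVecs d) (λ c → trans (∑-cong (allVecs n) (cong 𝟙 ∘ =V-sym (lincomb c b)))
                                             (∑-allVecs-δ n (lincomb c b) (λ _ → 1))) ⟩
      ∑ (allVecs d) (λ _ → 1)
        ≡⟨ ∑-allVecs-1 d ⟩
      p ^ d ∎
      where open ≡-Reasoning

    #-split : (Q P : V n → Bool) → Q ⊆ᵇ P → # P ≡ # (λ v → P v ∧ not (Q v)) + # Q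
    #-split Q P Q⊆P = trans (∑-cong (allVecs n) (λ v → split (P v) (Q v) (Q⊆P v))) (∑-+ (allVecs n) _ _)
      where
      split : ∀ a b → (b ≡ true → a ≡ true) → 𝟙 a ≡ 𝟙 (a ∧ not b) + 𝟙 b
      split true  true  _ = refl
      split true  false _ = refl
      split false true  b⇒a = ⊥-elim (false≢true (b⇒a refl))
      split false false _ = refl

    #-∖ : (Q P : V n → Bool) → Q ⊆ᵇ P → # (λ v → P v ∧ not (Q v)) ≡ # P ∸ # Q
    #-∖ Q P Q⊆P = sym (trans (cong (_∸ # Q) (#-split Q P Q⊆P)) (m+n∸n≡m _ (# Q)))

    #-mono : (Q P : V n → Bool) → Q ⊆ᵇ P → # Q ≤ # P
    #-mono Q P Q⊆P = subst (# Q ≤_) (sym (#-split Q P Q⊆P)) (m≤n+m _ _)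

    ≤#⇒⊇ : (Q P : V n → Bool) → Q ⊆ᵇ P → # P ≤ # Q → P ⊆ᵇ Q
    ≤#⇒⊇ Q P Q⊆P #P≤#Q v Pv with Q v in Qv
    ... | true  = refl
    ... | false = ⊥-elim (1+n≢0 (trans (cong₂ (λ a b → 𝟙 (a ∧ not b)) (sym Pv) (sym Qv))
                                       (∑≡0⇒≡0 (allVecs n) (λ v → 𝟙 (P v ∧ not (Q v))) #∖≡0 (∈-allVecs n v))))
      where
      #∖≡0 : # (λ v → P v ∧ not (Q v)) ≡ 0
      #∖≡0 = trans (#-∖ Q P Q⊆P) (m≤n⇒m∸n≡0 #P≤#Q)

    #≤p^n : (P : V n → Bool) → # P ≤ p ^ n
    #≤p^n P = subst (# P ≤_) #-true (#-mono P (λ _ → true) (λ _ _ → refl))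

    #-outside-span : ∀ {P} → IsLinear P → ∀ {d} (c : Vec (V n) d) → allᵛ P c ≡ true → Independent c →
                     # (λ x → P x ∧ not (inSpan c x)) ≡ # P ∸ p ^ d
    #-outside-span {P} lin c all indep =
      trans (#-∖ (inSpan c) P (span⊆ lin c all)) (cong (# P ∸_) (#-inSpan c indep))

  -- Counting independent tuples

  -- the number of ways to extend an independent i-tuple of a subspace with N elements by j vectors
  ∏∸p^ : ℕ → ℕ → ℕ → ℕ
  ∏∸p^ N i zero    = 1
  ∏∸p^ N i (suc j) = ∏∸p^ N i j * (N ∸ p ^ (j + i))

  module _ {n : ℕ} where

    ∑-tuples-suc : ∀ j (S : List (V n)) (f : Vec (V n) (suc j) → ℕ) →
                   ∑ (tuples (suc j) S) f ≡ ∑ S (λ x → ∑ (tuples j S) (λ b → f (x ∷ b)))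
    ∑-tuples-suc j S f =
      trans (∑-concatMap S (λ x → map (x ∷_) (tuples j S)) f) (∑-cong S (λ x → ∑-map (tuples j S) (x ∷_) f))

    #extensions : (P : V n → Bool) → ∀ {i} → Vec (V n) i → ℕ → ℕ
    #extensions P a j = ∑ (tuples j (allVecs n)) (λ b → 𝟙 (allᵛ P b ∧ linIndep (b ++ᵛ a)))

    #extensions≡∏∸p^ : ∀ {P} → IsLinear P → ∀ {i} (a : Vec (V n) i) → allᵛ P a ≡ true → Independent a →
                       ∀ j → #extensions P a j ≡ ∏∸p^ (# P) i j
    #extensions≡∏∸p^ {P} lin a allᵃ indep zero =
      cong (λ z → 𝟙 (true ∧ z) + 0) (Independent⇒linIndep a indep)
    #extensions≡∏∸p^ {P} lin {i} a allᵃ indep (suc j) = begin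
      #extensions P a (suc j)
        ≡⟨ ∑-tuples-suc j (allVecs n) _ ⟩
      ∑ (allVecs n) (λ x → ∑ tuplesʲ (λ b → 𝟙 ((P x ∧ allᵛ P b) ∧ linIndep (x ∷ (b ++ᵛ a)))))
        ≡⟨ ∑-cong (allVecs n) (λ x → ∑-cong tuplesʲ (new-vector x)) ⟩
      ∑ (allVecs n) (λ x → ∑ tuplesʲ (λ b → if extends b then 𝟙 (P x ∧ not (inSpan (b ++ᵛ a) x)) else 0))
        ≡⟨ ∑-comm (allVecs n) tuplesʲ _ ⟩
      ∑ tuplesʲ (λ b → ∑ (allVecs n) (λ x → if extends b then 𝟙 (P x ∧ not (inSpan (b ++ᵛ a) x)) else 0))
        ≡⟨ ∑-cong tuplesʲ (λ b → trans (∑-if (allVecs n) (extends b) _) (choices b)) ⟩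
      ∑ tuplesʲ (λ b → 𝟙 (extends b) * (# P ∸ p ^ (j + i)))
        ≡⟨ ∑-*ʳ tuplesʲ _ _ ⟩
      #extensions P a j * (# P ∸ p ^ (j + i))
        ≡⟨ cong (_* (# P ∸ p ^ (j + i))) (#extensions≡∏∸p^ lin a allᵃ indep j) ⟩
      ∏∸p^ (# P) i (suc j) ∎
      where
      open ≡-Reasoning
      tuplesʲ = tuples j (allVecs n)
      extends : Vec (V n) j → Bool
      extends b = allᵛ P b ∧ linIndep (b ++ᵛ a)

      new-vector : ∀ x b → 𝟙 ((P x ∧ allᵛ P b) ∧ linIndep (x ∷ (b ++ᵛ a)))
                         ≡ (if extends b then 𝟙 (P x ∧ not (inSpan (b ++ᵛ a) x)) else 0)
      new-vector x b = trans (cong (λ z → 𝟙 ((P x ∧ allᵛ P b) ∧ z)) (linIndep-∷ x (b ++ᵛ a)))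
                             (𝟙-∧-if (P x) (allᵛ P b) (linIndep (b ++ᵛ a)) (not (inSpan (b ++ᵛ a) x)))

      choices : ∀ b → (if extends b then # (λ x → P x ∧ not (inSpan (b ++ᵛ a) x)) else 0)
                    ≡ 𝟙 (extends b) * (# P ∸ p ^ (j + i))
      choices b with allᵛ P b in allᵇ | linIndep (b ++ᵛ a) in indepᵇ
      ... | false | _     = refl
      ... | true  | false = refl
      ... | true  | true  =
        trans (#-outside-span lin (b ++ᵛ a) (trans (allᵛ-++ P b a) (cong₂ _∧_ allᵇ allᵃ))
                              (linIndep⇒Independent (b ++ᵛ a) indepᵇ))
              (sym (+-identityʳ _))

  -- Subspaces, bases and dimension

  ^-injective : ∀ {a b} → p ^ a ≡ p ^ b → a ≡ b
  ^-injective {a} {b} eq with <-cmp a b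
  ... | tri≈ _ a≡b _ = a≡b
  ... | tri< a<b _ _ = ⊥-elim (<-irrefl eq (^-monoʳ-< p 1<p a<b))
  ... | tri> _ _ b<a = ⊥-elim (<-irrefl (sym eq) (^-monoʳ-< p 1<p b<a))

  ∑-applyUpTo-single : ∀ m (f h : ℕ → ℕ) i₀ → i₀ < m → (∀ i → i < m → i ≢ i₀ → h (f i) ≡ 0) →
                       ∑ (applyUpTo f m) h ≡ h (f i₀)
  ∑-applyUpTo-single (suc m) f h zero _ others =
    trans (cong (h (f 0) +_) (trans (∑-cong-∈ (applyUpTo (f ∘ suc) m) rest) (∑-zero (applyUpTo (f ∘ suc) m))))
          (+-identityʳ _)
    where
    rest : ∀ {y} → y ∈ applyUpTo (f ∘ suc) m → h y ≡ 0
    rest y∈ with ∈-applyUpTo⁻ (f ∘ suc) y∈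
    ... | i , i<m , refl = others (suc i) (s≤s i<m) λ ()
  ∑-applyUpTo-single (suc m) f h (suc i₀) (s≤s i₀<m) others =
    trans (cong (_+ ∑ (applyUpTo (f ∘ suc) m) h) (others 0 z<s λ ()))
          (∑-applyUpTo-single m (f ∘ suc) h i₀ i₀<m (λ i i<m i≢i₀ → others (suc i) (s≤s i<m) (i≢i₀ ∘ suc-injective)))

  module _ {n : ℕ} where

    isSubspace⇒IsLinear : (S : List (V n)) → isSubspace S ≡ true → IsLinear (_∈ᵇ S)
    isSubspace⇒IsLinear S sub = record
      { 0V∈       = proj₁ (∧-true sub)
      ; +V-closed = λ x y x∈ y∈ → all-∈ _ S (all-∈ _ S +closed (∈ᵇ⇒∈ S x∈)) (∈ᵇ⇒∈ S y∈)
      ; ·V-closed = λ a x x∈ → all-∈ _ S (all-∈ _ (allFin p) ·closed (∈-allFin a)) (∈ᵇ⇒∈ S x∈)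
      }
      where
      closed = proj₂ (∧-true {0V ∈ᵇ S} sub)
      +closed = proj₁ (∧-true closed)
      ·closed = proj₂ (∧-true {all (λ x → all (λ y → (x +V y) ∈ᵇ S) S) S} closed)

    IsLinear⇒isSubspace : (S : List (V n)) → IsLinear (_∈ᵇ S) → isSubspace S ≡ true
    IsLinear⇒isSubspace S lin = cong₂ _∧_ (IsLinear.0V∈ lin) (cong₂ _∧_
      (all-intro _ S (λ x∈ → all-intro _ S (λ y∈ → IsLinear.+V-closed lin _ _ (∈⇒∈ᵇ x∈) (∈⇒∈ᵇ y∈))))
      (all-intro _ (allFin p) (λ {a} _ → all-intro _ S (λ x∈ → IsLinear.·V-closed lin a _ (∈⇒∈ᵇ x∈)))))

    foldr-∈ᵇ≡allᵛ : (S : List (V n)) → ∀ {d} (b : Vec (V n) d) →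
                    Data.Vec.foldr _ (λ x r → (x ∈ᵇ S) ∧ r) true b ≡ allᵛ (_∈ᵇ S) b
    foldr-∈ᵇ≡allᵛ S []      = refl
    foldr-∈ᵇ≡allᵛ S (x ∷ b) = cong ((x ∈ᵇ S) ∧_) (foldr-∈ᵇ≡allᵛ S b)

    ∈-tuples : (S : List (V n)) → ∀ {d} (b : Vec (V n) d) → allᵛ (_∈ᵇ S) b ≡ true → b ∈ tuples d S
    ∈-tuples S []            _   = here refl
    ∈-tuples S {suc d} (x ∷ b) all =
      ∈-concat⁺′ (∈-map⁺ (x ∷_) (∈-tuples S b (proj₂ (∧-true all))))
                 (∈-map⁺ (λ x → map (x ∷_) (tuples d S)) (∈ᵇ⇒∈ S (proj₁ (∧-true all))))

    record Basis (S : List (V n)) (d : ℕ) : Set where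
      field
        vectors     : Vec (V n) d
        ⊆S          : allᵛ (_∈ᵇ S) vectors ≡ true
        independent : Independent vectors
        spans       : (_∈ᵇ S) ⊆ᵇ inSpan vectors

    hasDim⇒Basis : (S : List (V n)) (d : ℕ) → hasDim S d ≡ true → Basis S d
    hasDim⇒Basis S d dim with any-witness (λ b → isBasisOf b S) (tuples d S) dim
    ... | b , _ , basis = record
      { vectors     = b
      ; ⊆S          = trans (sym (foldr-∈ᵇ≡allᵛ S b)) (proj₁ (∧-true basis))
      ; independent = linIndep⇒Independent b (proj₁ (∧-true indep∧spans))
      ; spans       = λ x x∈ → all-∈ _ S (proj₂ (∧-true indep∧spans)) (∈ᵇ⇒∈ S x∈)
      }
      where indep∧spans = proj₂ (∧-true {Data.Vec.foldr _ (λ x r → (x ∈ᵇ S) ∧ r) true b} basis)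

    Basis⇒hasDim : (S : List (V n)) (d : ℕ) → Basis S d → hasDim S d ≡ true
    Basis⇒hasDim S d B = any-∈ (λ b → isBasisOf b S) (∈-tuples S vectors ⊆S)
      (cong₂ _∧_ (trans (foldr-∈ᵇ≡allᵛ S vectors) ⊆S)
                 (cong₂ _∧_ (Independent⇒linIndep _ independent)
                            (all-intro _ S (λ x∈ → spans _ (∈⇒∈ᵇ x∈)))))
      where open Basis B

    #-Basis : (S : List (V n)) → isSubspace S ≡ true → ∀ {d} → Basis S d → # (_∈ᵇ S) ≡ p ^ d
    #-Basis S sub B = trans
      (≤-antisym (#-mono (_∈ᵇ S) (inSpan vectors) spans)
                 (#-mono (inSpan vectors) (_∈ᵇ S) (span⊆ (isSubspace⇒IsLinear S sub) vectors ⊆S)))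
      (#-inSpan vectors independent)
      where open Basis B

    #-hasDim : (S : List (V n)) → isSubspace S ≡ true → ∀ d → hasDim S d ≡ true → # (_∈ᵇ S) ≡ p ^ d
    #-hasDim S sub d dim = #-Basis S sub (hasDim⇒Basis S d dim)

    Independent⇒≤n : ∀ {d} (b : Vec (V n) d) → Independent b → d ≤ n
    Independent⇒≤n {d} b indep = ≮⇒≥ λ n<d →
      ≤⇒≯ (subst (_≤ p ^ n) (#-inSpan b indep) (#≤p^n (inSpan b))) (^-monoʳ-< p 1<p n<d)

    -- An independent tuple in F_p^n has at most n vectors, so n ∸ d bounds the number of extension steps.
    extend-to-basis : (S : List (V n)) → isSubspace S ≡ true → ∀ fuel {d} (b : Vec (V n) d) → d + fuel ≡ n →
                      allᵛ (_∈ᵇ S) b ≡ true → Independent b → Σ ℕ (λ d′ → d′ ≤ n × hasDim S d′ ≡ true)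
    extend-to-basis S sub fuel {d} b d+fuel≡n ⊆S indep with all (inSpan b) S in spans
    ... | true = d , subst (d ≤_) d+fuel≡n (m≤m+n d fuel)
                   , Basis⇒hasDim S d (record { vectors = b ; ⊆S = ⊆S ; independent = indep
                                              ; spans = λ x x∈ → all-∈ _ S spans (∈ᵇ⇒∈ S x∈) })
    ... | false with all-counterexample _ S spans
    ... | x , x∈S , x∉span = continue fuel d+fuel≡n
      where
      ⊆S′ : allᵛ (_∈ᵇ S) (x ∷ b) ≡ true
      ⊆S′ = cong₂ _∧_ (∈⇒∈ᵇ x∈S) ⊆S
      indep′ : Independent (x ∷ b)
      indep′ = linIndep⇒Independent (x ∷ b)
                 (trans (linIndep-∷ x b) (cong₂ _∧_ (Independent⇒linIndep b indep) (cong not x∉span)))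
      continue : ∀ f → d + f ≡ n → Σ ℕ (λ d′ → d′ ≤ n × hasDim S d′ ≡ true)
      continue zero    d+0≡n = ⊥-elim (<-irrefl (trans (sym (+-identityʳ d)) d+0≡n) (Independent⇒≤n (x ∷ b) indep′))
      continue (suc f) d+f+1≡n = extend-to-basis S sub f (x ∷ b) (trans (sym (+-suc d f)) d+f+1≡n) ⊆S′ indep′

    dimension-exists : (S : List (V n)) → isSubspace S ≡ true → Σ ℕ (λ d → d ≤ n × hasDim S d ≡ true)
    dimension-exists S sub = extend-to-basis S sub n [] refl refl (λ { [] _ → refl })

    pdim≡# : (S : List (V n)) → isSubspace S ≡ true → pdim S ≡ # (_∈ᵇ S)
    pdim≡# S sub with dimension-exists S sub
    ... | d , d≤n , dim = begin
      pdim S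
        ≡⟨ foldr-+≡∑ (upTo (suc n)) _ ⟩
      ∑ (upTo (suc n)) (λ d′ → if hasDim S d′ then p ^ d′ else 0)
        ≡⟨ ∑-applyUpTo-single (suc n) (λ i → i) _ d (s≤s d≤n) other-dimensions ⟩
      (if hasDim S d then p ^ d else 0)
        ≡⟨ cong (λ z → if z then p ^ d else 0) dim ⟩
      p ^ d
        ≡⟨ sym (#-hasDim S sub d dim) ⟩
      # (_∈ᵇ S) ∎
      where
      open ≡-Reasoning
      other-dimensions : ∀ i → i < suc n → i ≢ d → (if hasDim S i then p ^ i else 0) ≡ 0
      other-dimensions i _ i≢d with hasDim S i in dimᵢ
      ... | false = refl
      ... | true  = ⊥-elim (i≢d (^-injective (trans (sym (#-hasDim S sub i dimᵢ)) (#-hasDim S sub d dim))))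

  -- Every independent tuple spans exactly one subspace

  _⇔ᵇ_ : Bool → Bool → Bool
  true  ⇔ᵇ b = b
  false ⇔ᵇ b = not b

  ⇔ᵇ⇒≡ : ∀ a b → (a ⇔ᵇ b) ≡ true → a ≡ b
  ⇔ᵇ⇒≡ true  true  _ = refl
  ⇔ᵇ⇒≡ false false _ = refl

  ⇔ᵇ-refl : ∀ a → (a ⇔ᵇ a) ≡ true
  ⇔ᵇ-refl true  = refl
  ⇔ᵇ-refl false = refl

  module _ {n : ℕ} where

    Unique-from-counts : (xs : List (V n)) → (∀ v → ∑ xs (λ y → 𝟙 (y =V v)) ≤ 1) → Unique xs
    Unique-from-counts []       _     = []
    Unique-from-counts (x ∷ xs) count≤1 =
      ¬Any⇒All¬ xs x∉xs ∷ Unique-from-counts xs (λ v → ≤-trans (m≤n+m _ (𝟙 (x =V v))) (count≤1 v))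
      where
      x∉xs : x ∈ xs → ⊥
      x∉xs x∈ = ≤⇒≯ (s≤s⁻¹ (subst (λ z → z + ∑ xs (λ y → 𝟙 (y =V x)) ≤ 1) x=x (count≤1 x)))
                    (subst (_≤ ∑ xs (λ y → 𝟙 (y =V x))) x=x (∈⇒≤∑ xs (λ y → 𝟙 (y =V x)) x∈))
        where x=x = cong 𝟙 (=V-refl x)

    Unique-allVecs : Unique (allVecs n)
    Unique-allVecs = Unique-from-counts (allVecs n) (λ v → ≤-reflexive (∑-allVecs-δ n v (λ _ → 1)))

    ∈-powerset⇒⊆ : ∀ (xs : List (V n)) {W y} → W ∈ powerset xs → y ∈ W → y ∈ xs
    ∈-powerset⇒⊆ []       (here refl) ()
    ∈-powerset⇒⊆ (x ∷ xs) {W} W∈ y∈ with ∈-++⁻ (map (x ∷_) (powerset xs)) W∈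
    ... | inj₂ W∈′ = there (∈-powerset⇒⊆ xs W∈′ y∈)
    ... | inj₁ W∈′ with ∈-map⁻ (x ∷_) W∈′
    ... | W′ , W′∈ , refl with y∈
    ... | here refl = here refl
    ... | there y∈′ = there (∈-powerset⇒⊆ xs W′∈ y∈′)

    matches : List (V n) → List (V n) → (V n → Bool) → Bool
    matches xs W Q = all (λ v → (v ∈ᵇ W) ⇔ᵇ Q v) xs

    matches-∷-∷ : ∀ x xs W Q → (x ∈ xs → ⊥) → matches (x ∷ xs) (x ∷ W) Q ≡ (Q x ∧ matches xs W Q)
    matches-∷-∷ x xs W Q x∉xs =
      cong₂ (λ a b → (a ⇔ᵇ Q x) ∧ b) (cong (_∨ (x ∈ᵇ W)) (=V-refl x)) (all-cong-∈ _ xs same-membership)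
      where
      same-membership : ∀ {v} → v ∈ xs → ((v ∈ᵇ (x ∷ W)) ⇔ᵇ Q v) ≡ ((v ∈ᵇ W) ⇔ᵇ Q v)
      same-membership {v} v∈ with =V-reflects v x
      ... | inj₁ (refl , _) = ⊥-elim (x∉xs v∈)
      ... | inj₂ (_ , v=x) rewrite v=x = refl

    matches-∷ : ∀ x xs W Q → (x ∈ W → ⊥) → matches (x ∷ xs) W Q ≡ (not (Q x) ∧ matches xs W Q)
    matches-∷ x xs W Q x∉W with x ∈ᵇ W in x∈W
    ... | true  = ⊥-elim (x∉W (∈ᵇ⇒∈ W x∈W))
    ... | false = refl

    ∑-powerset-matches : (xs : List (V n)) → Unique xs → (Q : V n → Bool) →
                         ∑ (powerset xs) (λ W → 𝟙 (matches xs W Q)) ≡ 1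
    ∑-powerset-matches []       _             Q = refl
    ∑-powerset-matches (x ∷ xs) (x≢xs ∷ uniq) Q = begin
      ∑ (map (x ∷_) (powerset xs) ++ powerset xs) (λ W → 𝟙 (matches (x ∷ xs) W Q))
        ≡⟨ ∑-++ (map (x ∷_) (powerset xs)) (powerset xs) _ ⟩
      ∑ (map (x ∷_) (powerset xs)) (λ W → 𝟙 (matches (x ∷ xs) W Q)) + ∑ (powerset xs) (λ W → 𝟙 (matches (x ∷ xs) W Q))
        ≡⟨ cong₂ _+_ (trans (∑-map (powerset xs) (x ∷_) _)
                            (∑-cong (powerset xs) (λ W → trans (cong 𝟙 (matches-∷-∷ x xs W Q x∉xs)) (𝟙-∧ (Q x) _))))
                     (∑-cong-∈ (powerset xs) (λ W∈ → trans (cong 𝟙 (matches-∷ x xs _ Q (x∉xs ∘ ∈-powerset⇒⊆ xs W∈)))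
                                                           (𝟙-∧ (not (Q x)) _))) ⟩
      ∑ (powerset xs) (λ W → if Q x then 𝟙 (matches xs W Q) else 0)
        + ∑ (powerset xs) (λ W → if not (Q x) then 𝟙 (matches xs W Q) else 0)
        ≡⟨ cong₂ _+_ (∑-if (powerset xs) (Q x) _) (∑-if (powerset xs) (not (Q x)) _) ⟩
      (if Q x then ∑ (powerset xs) (λ W → 𝟙 (matches xs W Q)) else 0)
        + (if not (Q x) then ∑ (powerset xs) (λ W → 𝟙 (matches xs W Q)) else 0)
        ≡⟨ exactly-one (Q x) ⟩
      1 ∎
      where
      open ≡-Reasoning
      x∉xs : x ∈ xs → ⊥
      x∉xs = All¬⇒¬Any x≢xs

      exactly-one : ∀ b → (if b then ∑ (powerset xs) (λ W → 𝟙 (matches xs W Q)) else 0)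
                          + (if not b then ∑ (powerset xs) (λ W → 𝟙 (matches xs W Q)) else 0) ≡ 1
      exactly-one true  = trans (+-identityʳ _) (∑-powerset-matches xs uniq Q)
      exactly-one false = ∑-powerset-matches xs uniq Q

    represents : List (V n) → (V n → Bool) → Bool
    represents W Q = matches (allVecs n) W Q

    represents⇒ : ∀ W Q → represents W Q ≡ true → ∀ v → (v ∈ᵇ W) ≡ Q v
    represents⇒ W Q rep v = ⇔ᵇ⇒≡ _ _ (all-∈ _ (allVecs n) rep (∈-allVecs n v))

    represents-intro : ∀ W Q → (∀ v → (v ∈ᵇ W) ≡ Q v) → represents W Q ≡ true
    represents-intro W Q same = all-intro _ (allVecs n)
      (λ {v} _ → subst (λ z → ((v ∈ᵇ W) ⇔ᵇ z) ≡ true) (same v) (⇔ᵇ-refl (v ∈ᵇ W)))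

    ∑-represents : (Q : V n → Bool) → ∑ (allSubsets n) (λ W → 𝟙 (represents W Q)) ≡ 1
    ∑-represents Q = ∑-powerset-matches (allVecs n) Unique-allVecs Q

    ⊇-independent⇒represents-span : ∀ W {k} (c : Vec (V n) k) → Independent c → isSubspace W ≡ true →
                                    hasDim W k ≡ true → allᵛ (_∈ᵇ W) c ≡ true → represents W (inSpan c) ≡ true
    ⊇-independent⇒represents-span W {k} c indep sub dim c⊆W = represents-intro W (inSpan c) same
      where
      span⊆W : inSpan c ⊆ᵇ (_∈ᵇ W)
      span⊆W = span⊆ (isSubspace⇒IsLinear W sub) c c⊆W
      W⊆span : (_∈ᵇ W) ⊆ᵇ inSpan c
      W⊆span = ≤#⇒⊇ (inSpan c) (_∈ᵇ W) span⊆W (≤-reflexive (trans (#-hasDim W sub k dim) (sym (#-inSpan c indep))))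
      same : ∀ v → (v ∈ᵇ W) ≡ inSpan c v
      same v with v ∈ᵇ W in v∈W
      ... | true = sym (W⊆span v v∈W)
      ... | false with inSpan c v in v∈span
      ...   | false = refl
      ...   | true  = trans (sym v∈W) (span⊆W v v∈span)

    represents-span⇒⊇-independent : ∀ W {k} (c : Vec (V n) k) → Independent c → represents W (inSpan c) ≡ true →
                                    isSubspace W ≡ true × hasDim W k ≡ true × allᵛ (_∈ᵇ W) c ≡ true
    represents-span⇒⊇-independent W {k} c indep rep = sub , dim , c⊆W
      where
      same = represents⇒ W (inSpan c) rep
      span = inSpan-isLinear c
      sub : isSubspace W ≡ true
      sub = IsLinear⇒isSubspace W (record
        { 0V∈       = trans (same 0V) (IsLinear.0V∈ span)
        ; +V-closed = λ x y x∈ y∈ →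
            trans (same _) (IsLinear.+V-closed span x y (trans (sym (same x)) x∈) (trans (sym (same y)) y∈))
        ; ·V-closed = λ a x x∈ → trans (same _) (IsLinear.·V-closed span a x (trans (sym (same x)) x∈))
        })
      c⊆W : allᵛ (_∈ᵇ W) c ≡ true
      c⊆W = allᵛ-mono (λ v v∈ → trans (same v) v∈) c (allᵛ-inSpan c)
      dim : hasDim W k ≡ true
      dim = Basis⇒hasDim W k (record { vectors = c ; ⊆S = c⊆W ; independent = indep
                                     ; spans = λ x x∈ → trans (sym (same x)) x∈ })

    isSubspace⊇ : ℕ → ∀ {i} → Vec (V n) i → List (V n) → Bool
    isSubspace⊇ k a W = (isSubspace W ∧ hasDim W k) ∧ allᵛ (_∈ᵇ W) a

    ⊇-independent≡represents-span : ∀ W {k} (c : Vec (V n) k) → Independent c →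
                                    isSubspace⊇ k c W ≡ represents W (inSpan c)
    ⊇-independent≡represents-span W {k} c indep with represents W (inSpan c) in rep
    ... | true with represents-span⇒⊇-independent W c indep rep
    ...   | sub , dim , c⊆W rewrite sub | dim | c⊆W = refl
    ⊇-independent≡represents-span W {k} c indep | false with isSubspace⊇ k c W in conditions
    ... | false = refl
    ... | true with ∧-true {isSubspace W ∧ hasDim W k} conditions
    ...   | sub∧dim , c⊆W =
      ⊥-elim (false≢true (trans (sym rep) (⊇-independent⇒represents-span W c indep (proj₁ (∧-true sub∧dim))
                                                                              (proj₂ (∧-true {isSubspace W} sub∧dim)) c⊆W)))

    ∑-subspaces-extension : ∀ {i j} (a : Vec (V n) i) (b : Vec (V n) j) →
      ∑ (allSubsets n) (λ W → if isSubspace⊇ (j + i) a W then 𝟙 (allᵛ (_∈ᵇ W) b ∧ linIndep (b ++ᵛ a)) else 0)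
        ≡ 𝟙 (linIndep (b ++ᵛ a))
    ∑-subspaces-extension {i} {j} a b with linIndep (b ++ᵛ a) in indep
    ... | false = trans (∑-cong (allSubsets n) (λ W → no-extension (isSubspace⊇ (j + i) a W) (allᵛ (_∈ᵇ W) b)))
                        (∑-zero (allSubsets n))
      where
      no-extension : ∀ c d → (if c then 𝟙 (d ∧ false) else 0) ≡ 0
      no-extension c d rewrite Boolₚ.∧-zeroʳ d with c
      ... | true  = refl
      ... | false = refl
    ... | true = trans (∑-cong (allSubsets n) spanned) (∑-represents (inSpan (b ++ᵛ a)))
      where
      regroup : ∀ Y A B → (if Y ∧ A then 𝟙 (B ∧ true) else 0) ≡ 𝟙 (Y ∧ (B ∧ A))
      regroup true  true  true  = refl
      regroup true  true  false = refl
      regroup true  false true  = refl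
      regroup true  false false = refl
      regroup false A     B     = refl

      spanned : ∀ W → (if isSubspace⊇ (j + i) a W then 𝟙 (allᵛ (_∈ᵇ W) b ∧ true) else 0)
                      ≡ 𝟙 (represents W (inSpan (b ++ᵛ a)))
      spanned W = trans (regroup (isSubspace W ∧ hasDim W (j + i)) (allᵛ (_∈ᵇ W) a) (allᵛ (_∈ᵇ W) b))
        (cong 𝟙 (trans (cong ((isSubspace W ∧ hasDim W (j + i)) ∧_) (sym (allᵛ-++ (_∈ᵇ W) b a)))
                       (⊇-independent≡represents-span W (b ++ᵛ a) (linIndep⇒Independent (b ++ᵛ a) indep))))

    ∑-subspaces-#extensions : ∀ {i} (a : Vec (V n) i) → ∀ j →
      ∑ (allSubsets n) (λ W → if isSubspace⊇ (j + i) a W then #extensions (_∈ᵇ W) a j else 0)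
        ≡ #extensions (λ _ → true) a j
    ∑-subspaces-#extensions {i} a j = begin
      ∑ (allSubsets n) (λ W → if isSubspace⊇ (j + i) a W then #extensions (_∈ᵇ W) a j else 0)
        ≡⟨ ∑-cong (allSubsets n) (λ W → sym (∑-if tuplesʲ (isSubspace⊇ (j + i) a W) _)) ⟩
      ∑ (allSubsets n) (λ W → ∑ tuplesʲ (λ b → if isSubspace⊇ (j + i) a W then 𝟙 (allᵛ (_∈ᵇ W) b ∧ linIndep (b ++ᵛ a)) else 0))
        ≡⟨ ∑-comm (allSubsets n) tuplesʲ _ ⟩
      ∑ tuplesʲ (λ b → ∑ (allSubsets n) (λ W → if isSubspace⊇ (j + i) a W then 𝟙 (allᵛ (_∈ᵇ W) b ∧ linIndep (b ++ᵛ a)) else 0))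
        ≡⟨ ∑-cong tuplesʲ (λ b → trans (∑-subspaces-extension a b) (cong (λ z → 𝟙 (z ∧ linIndep (b ++ᵛ a))) (sym (allᵛ-true b)))) ⟩
      #extensions (λ _ → true) a j ∎
      where
      open ≡-Reasoning
      tuplesʲ = tuples j (allVecs n)

  -- From products p^m − p^t to q-factorials

  p∸1 : ℕ
  p∸1 = p ∸ 1

  p≡p∸1+1 : p ≡ p∸1 + 1
  p≡p∸1+1 = sym (trans (+-comm p∸1 1) (m+[n∸m]≡n (<-trans z<s 1<p)))

  qint-geometric : ∀ a → p∸1 * qint p a + 1 ≡ p ^ a
  qint-geometric zero    = cong (_+ 1) (*-zeroʳ p∸1)
  qint-geometric (suc a) = begin
    p∸1 * (1 + p * qint p a) + 1              ≡⟨ cong (λ P → p∸1 * (1 + P * qint p a) + 1) p≡p∸1+1 ⟩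
    p∸1 * (1 + (p∸1 + 1) * qint p a) + 1      ≡⟨ solve p∸1 (qint p a) ⟩
    (p∸1 + 1) * (p∸1 * qint p a + 1)          ≡⟨ cong₂ _*_ (sym p≡p∸1+1) (qint-geometric a) ⟩
    p * p ^ a                                 ∎
    where
    open ≡-Reasoning
    solve : ∀ x Q → x * (1 + (x + 1) * Q) + 1 ≡ (x + 1) * (x * Q + 1)
    solve = solve-∀

  p^m∸p^j : ∀ {j m} → j ≤ m → p ^ m ∸ p ^ j ≡ p ^ j * p∸1 * qint p (m ∸ j)
  p^m∸p^j {j} {m} j≤m = begin
    p ^ m ∸ p ^ j                                   ≡⟨ cong (λ z → p ^ z ∸ p ^ j) (sym (m+[n∸m]≡n j≤m)) ⟩
    p ^ (j + (m ∸ j)) ∸ p ^ j                       ≡⟨ cong (_∸ p ^ j) (^-distribˡ-+-* p j (m ∸ j)) ⟩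
    p ^ j * p ^ (m ∸ j) ∸ p ^ j                     ≡⟨ cong (λ z → p ^ j * z ∸ p ^ j) (sym (qint-geometric (m ∸ j))) ⟩
    p ^ j * (p∸1 * qint p (m ∸ j) + 1) ∸ p ^ j      ≡⟨ cong (_∸ p ^ j) (solve (p ^ j) p∸1 (qint p (m ∸ j))) ⟩
    p ^ j * p∸1 * qint p (m ∸ j) + p ^ j ∸ p ^ j    ≡⟨ m+n∸n≡m _ (p ^ j) ⟩
    p ^ j * p∸1 * qint p (m ∸ j)                    ∎
    where
    open ≡-Reasoning
    solve : ∀ a b c → a * (b * c + 1) ≡ a * b * c + a
    solve = solve-∀

  powerPart : ℕ → ℕ
  powerPart zero    = 1
  powerPart (suc j) = powerPart j * (p ^ j * p∸1)

  qFalling : ℕ → ℕ → ℕ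
  qFalling m zero    = 1
  qFalling m (suc j) = qFalling m j * qint p (m ∸ j)

  powerPart≢0 : ∀ j → NonZero (powerPart j)
  powerPart≢0 zero    = _
  powerPart≢0 (suc j) = m*n≢0 (powerPart j) _ {{powerPart≢0 j}} {{m*n≢0 (p ^ j) p∸1 {{m^n≢0 p j}} {{p∸1≢0}}}}
    where
    p∸1≢0 : NonZero p∸1
    p∸1≢0 = ≢-nonZero λ p∸1≡0 → <-irrefl (sym (trans p≡p∸1+1 (cong (_+ 1) p∸1≡0))) 1<p

  ∏∸p^≡powerPart*qFalling : ∀ j m → j ≤ m → ∏∸p^ (p ^ m) 0 j ≡ powerPart j * qFalling m j
  ∏∸p^≡powerPart*qFalling zero    m _   = refl
  ∏∸p^≡powerPart*qFalling (suc j) m j<m = begin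
    ∏∸p^ (p ^ m) 0 j * (p ^ m ∸ p ^ (j + 0))
      ≡⟨ cong₂ _*_ (∏∸p^≡powerPart*qFalling j m (<⇒≤ j<m)) (cong (λ z → p ^ m ∸ p ^ z) (+-identityʳ j)) ⟩
    powerPart j * qFalling m j * (p ^ m ∸ p ^ j)
      ≡⟨ cong (powerPart j * qFalling m j *_) (p^m∸p^j (<⇒≤ j<m)) ⟩
    powerPart j * qFalling m j * (p ^ j * p∸1 * qint p (m ∸ j))
      ≡⟨ solve (powerPart j) (qFalling m j) (p ^ j * p∸1) (qint p (m ∸ j)) ⟩
    powerPart j * (p ^ j * p∸1) * (qFalling m j * qint p (m ∸ j)) ∎
    where
    open ≡-Reasoning
    solve : ∀ a b c d → a * b * (c * d) ≡ a * c * (b * d)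
    solve = solve-∀

  qFalling*qfact≡qfact : ∀ j m → j ≤ m → qFalling m j * qfact p (m ∸ j) ≡ qfact p m
  qFalling*qfact≡qfact zero    m _   = +-identityʳ _
  qFalling*qfact≡qfact (suc j) m j<m = begin
    qFalling m j * qint p (m ∸ j) * qfact p (m ∸ suc j)     ≡⟨ *-assoc (qFalling m j) _ _ ⟩
    qFalling m j * (qint p (m ∸ j) * qfact p (m ∸ suc j))   ≡⟨ cong (λ z → qFalling m j * (qint p z * qfact p (m ∸ suc j))) m∸j≡1+m∸[1+j] ⟩
    qFalling m j * qfact p (suc (m ∸ suc j))                ≡⟨ cong (λ z → qFalling m j * qfact p z) (sym m∸j≡1+m∸[1+j]) ⟩
    qFalling m j * qfact p (m ∸ j)                          ≡⟨ qFalling*qfact≡qfact j m (<⇒≤ j<m) ⟩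
    qfact p m                                               ∎
    where
    open ≡-Reasoning
    m∸j≡1+m∸[1+j] : m ∸ j ≡ suc (m ∸ suc j)
    m∸j≡1+m∸[1+j] = +-∸-assoc 1 j<m

  *qfact≡qfact⇒G≡ : ∀ {k n C} → k ≤ n → C * (qfact p k * qfact p (n ∸ k)) ≡ qfact p n → G p k n ≡ C
  *qfact≡qfact⇒G≡ {k} {n} {C} k≤n eq rewrite Equivalence.to Boolₚ.T-≡ (≤⇒≤ᵇ k≤n) =
    trans (cong (λ z → _/_ z (qfact p k * qfact p (n ∸ k)) {{qfact2-nz p k (n ∸ k)}}) (sym eq))
          (m*n/n≡m C _ {{qfact2-nz p k (n ∸ k)}})

  ∏∸p^-ratio⇒*qfact≡qfact : ∀ {k n C} → k ≤ n → C * ∏∸p^ (p ^ k) 0 k ≡ ∏∸p^ (p ^ n) 0 k →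
                            C * (qfact p k * qfact p (n ∸ k)) ≡ qfact p n
  ∏∸p^-ratio⇒*qfact≡qfact {k} {n} {C} k≤n ratio = begin
    C * (qfact p k * qfact p (n ∸ k))          ≡⟨ cong (λ z → C * (z * qfact p (n ∸ k))) (sym qFalling-k-k) ⟩
    C * (qFalling k k * qfact p (n ∸ k))       ≡⟨ sym (*-assoc C _ _) ⟩
    C * qFalling k k * qfact p (n ∸ k)         ≡⟨ cong (_* qfact p (n ∸ k)) qFalling-ratio ⟩
    qFalling n k * qfact p (n ∸ k)             ≡⟨ qFalling*qfact≡qfact k n k≤n ⟩
    qfact p n                                  ∎
    where
    open ≡-Reasoning
    qFalling-k-k : qFalling k k ≡ qfact p k
    qFalling-k-k = trans (sym (*-identityʳ (qFalling k k)))
                         (trans (cong (λ z → qFalling k k * qfact p z) (sym (n∸n≡0 k))) (qFalling*qfact≡qfact k k ≤-refl))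
    qFalling-ratio : C * qFalling k k ≡ qFalling n k
    qFalling-ratio = *-cancelˡ-≡ (C * qFalling k k) (qFalling n k) (powerPart k) {{powerPart≢0 k}} (begin
      powerPart k * (C * qFalling k k)   ≡⟨ solve (powerPart k) C (qFalling k k) ⟩
      C * (powerPart k * qFalling k k)   ≡⟨ cong (C *_) (sym (∏∸p^≡powerPart*qFalling k k ≤-refl)) ⟩
      C * ∏∸p^ (p ^ k) 0 k               ≡⟨ ratio ⟩
      ∏∸p^ (p ^ n) 0 k                   ≡⟨ ∏∸p^≡powerPart*qFalling k n k≤n ⟩
      powerPart k * qFalling n k         ∎)
      where
      solve : ∀ a b c → a * (b * c) ≡ b * (a * c)
      solve = solve-∀

  ∏∸p^-shift : ∀ m j → ∏∸p^ (p ^ suc m) 1 j ≡ p ^ j * ∏∸p^ (p ^ m) 0 j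
  ∏∸p^-shift m zero    = refl
  ∏∸p^-shift m (suc j) = begin
    ∏∸p^ (p ^ suc m) 1 j * (p ^ suc m ∸ p ^ (j + 1))
      ≡⟨ cong₂ _*_ (∏∸p^-shift m j) (cong (λ z → p ^ suc m ∸ p ^ z) (+-comm j 1)) ⟩
    p ^ j * ∏∸p^ (p ^ m) 0 j * (p * p ^ m ∸ p * p ^ j)
      ≡⟨ cong (p ^ j * ∏∸p^ (p ^ m) 0 j *_) (sym (*-distribˡ-∸ p (p ^ m) (p ^ j))) ⟩
    p ^ j * ∏∸p^ (p ^ m) 0 j * (p * (p ^ m ∸ p ^ j))
      ≡⟨ solve (p ^ j) (∏∸p^ (p ^ m) 0 j) p (p ^ m ∸ p ^ j) ⟩
    p * p ^ j * (∏∸p^ (p ^ m) 0 j * (p ^ m ∸ p ^ j))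
      ≡⟨ cong (λ z → p * p ^ j * (∏∸p^ (p ^ m) 0 j * (p ^ m ∸ p ^ z))) (sym (+-identityʳ j)) ⟩
    p * p ^ j * (∏∸p^ (p ^ m) 0 j * (p ^ m ∸ p ^ (j + 0))) ∎
    where
    open ≡-Reasoning
    solve : ∀ a b c d → a * b * (c * d) ≡ c * a * (b * d)
    solve = solve-∀

  -- Counting subspaces

  module _ {n : ℕ} where

    #subspaces⊇ : ∀ {i} → Vec (V n) i → ℕ → ℕ
    #subspaces⊇ a m = ∑ (allSubsets n) (𝟙 ∘ isSubspace⊇ m a)

    true-isLinear : IsLinear {n} (λ _ → true)
    true-isLinear = record { 0V∈ = refl ; +V-closed = λ _ _ _ _ → refl ; ·V-closed = λ _ _ _ → refl }

    #subspaces⊇-independent : ∀ {i} (a : Vec (V n) i) → Independent a → ∀ j →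
                              #subspaces⊇ a (j + i) * ∏∸p^ (p ^ (j + i)) i j ≡ ∏∸p^ (p ^ n) i j
    #subspaces⊇-independent {i} a indep j = begin
      #subspaces⊇ a (j + i) * ∏∸p^ (p ^ (j + i)) i j
        ≡⟨ sym (∑-*ʳ (allSubsets n) _ _) ⟩
      ∑ (allSubsets n) (λ W → 𝟙 (⊇a W) * ∏∸p^ (p ^ (j + i)) i j)
        ≡⟨ ∑-cong (allSubsets n) extensions-in ⟩
      ∑ (allSubsets n) (λ W → if ⊇a W then #extensions (_∈ᵇ W) a j else 0)
        ≡⟨ ∑-subspaces-#extensions a j ⟩
      #extensions (λ _ → true) a j
        ≡⟨ #extensions≡∏∸p^ true-isLinear a (allᵛ-true a) indep j ⟩
      ∏∸p^ (# {n} (λ _ → true)) i j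
        ≡⟨ cong (λ z → ∏∸p^ z i j) (#-true {n}) ⟩
      ∏∸p^ (p ^ n) i j ∎
      where
      open ≡-Reasoning
      ⊇a = isSubspace⊇ (j + i) a
      extensions-in : ∀ W → 𝟙 (⊇a W) * ∏∸p^ (p ^ (j + i)) i j ≡ (if ⊇a W then #extensions (_∈ᵇ W) a j else 0)
      extensions-in W with ⊇a W in ⊇a≡
      ... | false = refl
      ... | true with ∧-true {isSubspace W ∧ hasDim W (j + i)} ⊇a≡
      ...   | sub∧dim , a⊆W with ∧-true {isSubspace W} sub∧dim
      ...     | sub , dim = trans (+-identityʳ _)
        (sym (trans (#extensions≡∏∸p^ (isSubspace⇒IsLinear W sub) a a⊆W indep j)
                    (cong (λ z → ∏∸p^ z i j) (#-hasDim W sub (j + i) dim))))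

    Independent-[] : Independent {n} []
    Independent-[] [] _ = refl

    #subspaces*qfact≡qfact : ∀ k → k ≤ n → #subspaces⊇ [] k * (qfact p k * qfact p (n ∸ k)) ≡ qfact p n
    #subspaces*qfact≡qfact k k≤n = ∏∸p^-ratio⇒*qfact≡qfact {C = #subspaces⊇ [] k} k≤n
      (subst (λ m → #subspaces⊇ [] m * ∏∸p^ (p ^ m) 0 k ≡ ∏∸p^ (p ^ n) 0 k) (+-identityʳ k)
             (#subspaces⊇-independent [] Independent-[] k))

    G≡#subspaces : ∀ k → k ≤ n → G p k n ≡ #subspaces⊇ [] k
    G≡#subspaces k k≤n = *qfact≡qfact⇒G≡ k≤n (#subspaces*qfact≡qfact k k≤n)

    G*qfact≡qfact : ∀ k → k ≤ n → G p k n * (qfact p k * qfact p (n ∸ k)) ≡ qfact p n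
    G*qfact≡qfact k k≤n =
      trans (cong (_* (qfact p k * qfact p (n ∸ k))) (G≡#subspaces k k≤n)) (#subspaces*qfact≡qfact k k≤n)

    #subspaces∋ : V n → ℕ → ℕ
    #subspaces∋ v k = ∑ (allSubsets n) (λ W → 𝟙 ((isSubspace W ∧ hasDim W k) ∧ (v ∈ᵇ W)))

    #subspaces∋0V : ∀ k → k ≤ n → #subspaces∋ 0V k ≡ G p k n
    #subspaces∋0V k k≤n = trans (∑-cong (allSubsets n) contains-0V) (sym (G≡#subspaces k k≤n))
      where
      contains-0V : ∀ W → 𝟙 ((isSubspace W ∧ hasDim W k) ∧ (0V ∈ᵇ W)) ≡ 𝟙 ((isSubspace W ∧ hasDim W k) ∧ true)
      contains-0V W with isSubspace W in sub
      ... | false = refl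
      ... | true rewrite IsLinear.0V∈ (isSubspace⇒IsLinear W sub) = refl

    #0-dim-subspaces∋-nonzero : ∀ v → v ≢ 0V → #subspaces∋ v 0 ≡ 0
    #0-dim-subspaces∋-nonzero v v≢0 = trans (∑-cong (allSubsets n) not-in) (∑-zero (allSubsets n))
      where
      not-in : ∀ W → 𝟙 ((isSubspace W ∧ hasDim W 0) ∧ (v ∈ᵇ W)) ≡ 0
      not-in W with isSubspace W ∧ hasDim W 0 in sub∧dim
      ... | false = refl
      ... | true with v ∈ᵇ W in v∈W
      ...   | false = refl
      ...   | true  = ⊥-elim (v≢0 (only-0V (Basis.vectors B) (Basis.spans B v v∈W)))
        where
        B = hasDim⇒Basis W 0 (proj₂ (∧-true {isSubspace W} sub∧dim))
        only-0V : (b : Vec (V n) 0) → inSpan b v ≡ true → v ≡ 0V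
        only-0V [] v∈ with inSpan⇒InSpan [] v∈
        ... | [] , 0V≡v = sym 0V≡v

    #subspaces∋-nonzero : ∀ v → v ≢ 0V → ∀ k → suc k ≤ n → #subspaces∋ v (suc k) ≡ Gpred p (suc k) n
    #subspaces∋-nonzero v v≢0 k k<n = sym (*qfact≡qfact⇒G≡ k≤n-1 (∏∸p^-ratio⇒*qfact≡qfact {C = #subspaces∋ v (suc k)} k≤n-1 base-ratio))
      where
      n-1 = n ∸ 1
      n≡1+n-1 : n ≡ suc n-1
      n≡1+n-1 = sym (m+[n∸m]≡n (≤-trans (s≤s z≤n) k<n))
      k≤n-1 : k ≤ n-1
      k≤n-1 = s≤s⁻¹ (subst (suc k ≤_) n≡1+n-1 k<n)
      indep : Independent (v ∷ [])
      indep = Independent-∷ v [] Independent-[] (λ { ([] , 0V≡v) → v≢0 (sym 0V≡v) })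
      #∋≡#⊇ : #subspaces∋ v (suc k) ≡ #subspaces⊇ (v ∷ []) (k + 1)
      #∋≡#⊇ = trans (∑-cong (allSubsets n) (λ W → cong (λ z → 𝟙 ((isSubspace W ∧ hasDim W (suc k)) ∧ z))
                                                        (sym (Boolₚ.∧-identityʳ (v ∈ᵇ W)))))
                    (cong (#subspaces⊇ (v ∷ [])) (+-comm 1 k))
      ratio : #subspaces∋ v (suc k) * ∏∸p^ (p ^ suc k) 1 k ≡ ∏∸p^ (p ^ suc n-1) 1 k
      ratio = begin
        #subspaces∋ v (suc k) * ∏∸p^ (p ^ suc k) 1 k
          ≡⟨ cong₂ (λ a b → a * ∏∸p^ (p ^ b) 1 k) #∋≡#⊇ (+-comm 1 k) ⟩
        #subspaces⊇ (v ∷ []) (k + 1) * ∏∸p^ (p ^ (k + 1)) 1 k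
          ≡⟨ #subspaces⊇-independent (v ∷ []) indep k ⟩
        ∏∸p^ (p ^ n) 1 k
          ≡⟨ cong (λ z → ∏∸p^ (p ^ z) 1 k) n≡1+n-1 ⟩
        ∏∸p^ (p ^ suc n-1) 1 k ∎
        where open ≡-Reasoning
      base-ratio : #subspaces∋ v (suc k) * ∏∸p^ (p ^ k) 0 k ≡ ∏∸p^ (p ^ n-1) 0 k
      base-ratio = *-cancelˡ-≡ _ _ (p ^ k) {{m^n≢0 p k}} (begin
        p ^ k * (#subspaces∋ v (suc k) * ∏∸p^ (p ^ k) 0 k)   ≡⟨ solve (p ^ k) (#subspaces∋ v (suc k)) _ ⟩
        #subspaces∋ v (suc k) * (p ^ k * ∏∸p^ (p ^ k) 0 k)   ≡⟨ cong (#subspaces∋ v (suc k) *_) (sym (∏∸p^-shift k k)) ⟩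
        #subspaces∋ v (suc k) * ∏∸p^ (p ^ suc k) 1 k         ≡⟨ ratio ⟩
        ∏∸p^ (p ^ suc n-1) 1 k                                ≡⟨ ∏∸p^-shift n-1 k ⟩
        p ^ k * ∏∸p^ (p ^ n-1) 0 k                            ∎)
        where
        open ≡-Reasoning
        solve : ∀ a b c → a * (b * c) ≡ b * (a * c)
        solve = solve-∀

    #subspaces∋≡ : ∀ k → k ≤ n → ∀ v → #subspaces∋ v k ≡ (if v =V 0V then G p k n else Gpred p k n)
    #subspaces∋≡ k k≤n v with =V-reflects v 0V
    ... | inj₁ (refl , v=0) rewrite v=0 = #subspaces∋0V k k≤n
    ... | inj₂ (v≢0 , v=0) rewrite v=0 with k
    ...   | zero  = #0-dim-subspaces∋-nonzero v v≢0
    ...   | suc k′ = #subspaces∋-nonzero v v≢0 k′ k≤n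

    ∈ᵇ-∩ : ∀ (v : V n) (W U : List (V n)) → (v ∈ᵇ (W ∩ U)) ≡ ((v ∈ᵇ W) ∧ (v ∈ᵇ U))
    ∈ᵇ-∩ v []      U = refl
    ∈ᵇ-∩ v (x ∷ W) U with x ∈ᵇ U in x∈U | =V-reflects v x
    ... | true  | inj₁ (refl , v=x) rewrite v=x | x∈U = refl
    ... | true  | inj₂ (_ , v=x)    rewrite v=x = ∈ᵇ-∩ v W U
    ... | false | inj₁ (refl , v=x) rewrite v=x | x∈U =
      trans (∈ᵇ-∩ v W U) (trans (cong ((v ∈ᵇ W) ∧_) x∈U) (Boolₚ.∧-zeroʳ _))
    ... | false | inj₂ (_ , v=x)    rewrite v=x = ∈ᵇ-∩ v W U

    ∩-isSubspace : (W U : List (V n)) → isSubspace W ≡ true → isSubspace U ≡ true → isSubspace (W ∩ U) ≡ true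
    ∩-isSubspace W U subW subU = IsLinear⇒isSubspace (W ∩ U) (record
      { 0V∈       = both 0V (IsLinear.0V∈ linW) (IsLinear.0V∈ linU)
      ; +V-closed = λ x y x∈ y∈ → both _ (IsLinear.+V-closed linW x y (inW x x∈) (inW y y∈))
                                          (IsLinear.+V-closed linU x y (inU x x∈) (inU y y∈))
      ; ·V-closed = λ a x x∈ → both _ (IsLinear.·V-closed linW a x (inW x x∈)) (IsLinear.·V-closed linU a x (inU x x∈))
      })
      where
      linW = isSubspace⇒IsLinear W subW
      linU = isSubspace⇒IsLinear U subU
      both : ∀ v → (v ∈ᵇ W) ≡ true → (v ∈ᵇ U) ≡ true → (v ∈ᵇ (W ∩ U)) ≡ true
      both v v∈W v∈U = trans (∈ᵇ-∩ v W U) (cong₂ _∧_ v∈W v∈U)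
      inW : ∀ v → (v ∈ᵇ (W ∩ U)) ≡ true → (v ∈ᵇ W) ≡ true
      inW v v∈ = proj₁ (∧-true (trans (sym (∈ᵇ-∩ v W U)) v∈))
      inU : ∀ v → (v ∈ᵇ (W ∩ U)) ≡ true → (v ∈ᵇ U) ≡ true
      inU v v∈ = proj₂ (∧-true {v ∈ᵇ W} (trans (sym (∈ᵇ-∩ v W U)) v∈))

    ν≡∑-#subspaces∋ : ∀ (U : List (V n)) k → isSubspace U ≡ true →
                      ν U k ≡ ∑ (allVecs n) (λ v → if v ∈ᵇ U then #subspaces∋ v k else 0)
    ν≡∑-#subspaces∋ U k subU = begin
      ν U k
        ≡⟨ foldr-+≡∑ (allSubsets n) _ ⟩
      ∑ (allSubsets n) (λ W → if subspaceᵏ W then pdim (W ∩ U) else 0)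
        ≡⟨ ∑-cong (allSubsets n) pdim-∩ ⟩
      ∑ (allSubsets n) (λ W → if subspaceᵏ W then ∑ (allVecs n) (λ v → 𝟙 ((v ∈ᵇ W) ∧ (v ∈ᵇ U))) else 0)
        ≡⟨ ∑-cong (allSubsets n) (λ W → sym (∑-if (allVecs n) (subspaceᵏ W) _)) ⟩
      ∑ (allSubsets n) (λ W → ∑ (allVecs n) (λ v → if subspaceᵏ W then 𝟙 ((v ∈ᵇ W) ∧ (v ∈ᵇ U)) else 0))
        ≡⟨ ∑-comm (allSubsets n) (allVecs n) _ ⟩
      ∑ (allVecs n) (λ v → ∑ (allSubsets n) (λ W → if subspaceᵏ W then 𝟙 ((v ∈ᵇ W) ∧ (v ∈ᵇ U)) else 0))
        ≡⟨ ∑-cong (allVecs n) (λ v → trans (∑-cong (allSubsets n) (λ W → regroup (subspaceᵏ W) (v ∈ᵇ W) (v ∈ᵇ U)))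
                                           (∑-if (allSubsets n) (v ∈ᵇ U) _)) ⟩
      ∑ (allVecs n) (λ v → if v ∈ᵇ U then #subspaces∋ v k else 0) ∎
      where
      open ≡-Reasoning
      subspaceᵏ : List (V n) → Bool
      subspaceᵏ W = isSubspace W ∧ hasDim W k

      pdim-∩ : ∀ W → (if subspaceᵏ W then pdim (W ∩ U) else 0)
                   ≡ (if subspaceᵏ W then ∑ (allVecs n) (λ v → 𝟙 ((v ∈ᵇ W) ∧ (v ∈ᵇ U))) else 0)
      pdim-∩ W with subspaceᵏ W in subW
      ... | false = refl
      ... | true  = trans (pdim≡# (W ∩ U) (∩-isSubspace W U (proj₁ (∧-true subW)) subU))
                          (∑-cong (allVecs n) (λ v → cong 𝟙 (∈ᵇ-∩ v W U)))

      regroup : ∀ c a b → (if c then 𝟙 (a ∧ b) else 0) ≡ (if b then 𝟙 (c ∧ a) else 0)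
      regroup true  a     true  = cong 𝟙 (Boolₚ.∧-identityʳ a)
      regroup true  a     false = cong 𝟙 (Boolₚ.∧-zeroʳ a)
      regroup false a     true  = refl
      regroup false a     false = refl

    ν≡ : ∀ (U : List (V n)) k l → k ≤ n → isSubspace U ≡ true → hasDim U l ≡ true →
         ν U k ≡ G p k n + (p ^ l ∸ 1) * Gpred p k n
    ν≡ U k l k≤n subU dimU = begin
      ν U k
        ≡⟨ ν≡∑-#subspaces∋ U k subU ⟩
      ∑ (allVecs n) (λ v → if v ∈ᵇ U then #subspaces∋ v k else 0)
        ≡⟨ ∑-cong (allVecs n) (λ v → cong (λ z → if v ∈ᵇ U then z else 0) (#subspaces∋≡ k k≤n v)) ⟩
      ∑ (allVecs n) (λ v → if v ∈ᵇ U then (if v =V 0V then G p k n else Gpred p k n) else 0)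
        ≡⟨ ∑-cong (allVecs n) (λ v → split (v ∈ᵇ U) (v =V 0V) (0V∈U v)) ⟩
      ∑ (allVecs n) (λ v → (if v =V 0V then G p k n else 0) + 𝟙 ((v ∈ᵇ U) ∧ not (v =V 0V)) * Gpred p k n)
        ≡⟨ ∑-+ (allVecs n) _ _ ⟩
      ∑ (allVecs n) (λ v → if v =V 0V then G p k n else 0) + ∑ (allVecs n) (λ v → 𝟙 ((v ∈ᵇ U) ∧ not (v =V 0V)) * Gpred p k n)
        ≡⟨ cong₂ _+_ (∑-allVecs-δ n 0V (λ _ → G p k n)) (∑-*ʳ (allVecs n) _ _) ⟩
      G p k n + # (λ v → (v ∈ᵇ U) ∧ not (v =V 0V)) * Gpred p k n
        ≡⟨ cong (λ z → G p k n + z * Gpred p k n) (#-∖ (_=V 0V) (_∈ᵇ U) 0V∈U) ⟩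
      G p k n + (# (_∈ᵇ U) ∸ # {n} (_=V 0V)) * Gpred p k n
        ≡⟨ cong₂ (λ a b → G p k n + (a ∸ b) * Gpred p k n) (#-hasDim U subU l dimU) (∑-allVecs-δ n 0V (λ _ → 1)) ⟩
      G p k n + (p ^ l ∸ 1) * Gpred p k n ∎
      where
      open ≡-Reasoning
      0V∈U : (_=V 0V) ⊆ᵇ (_∈ᵇ U)
      0V∈U v v=0 = subst (λ z → (z ∈ᵇ U) ≡ true) (sym (=V⇒≡ v=0)) (IsLinear.0V∈ (isSubspace⇒IsLinear U subU))

      split : ∀ u z {a b} → (z ≡ true → u ≡ true) →
              (if u then (if z then a else b) else 0) ≡ (if z then a else 0) + 𝟙 (u ∧ not z) * b
      split true  true  {a}     _   = sym (+-identityʳ a)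
      split true  false {b = b} _   = sym (+-identityʳ b)
      split false true          z⇒u = ⊥-elim (false≢true (z⇒u refl))
      split false false         _   = refl

  -- Gaussian binomial identities

  G-> : ∀ {k n} → n < k → G p k n ≡ 0
  G-> {k} {n} n<k with k ≤ᵇ n in k≤ᵇn
  ... | false = refl
  ... | true  = ⊥-elim (<⇒≱ n<k (≤ᵇ⇒≤ k n (Equivalence.from Boolₚ.T-≡ k≤ᵇn)))

  G-complement : ∀ {k n} → k ≤ n → G p (n ∸ k) n ≡ G p k n
  G-complement {k} {n} k≤n = *qfact≡qfact⇒G≡ (m∸n≤m n k) (begin
    G p k n * (qfact p (n ∸ k) * qfact p (n ∸ (n ∸ k)))  ≡⟨ cong (λ z → G p k n * (qfact p (n ∸ k) * qfact p z)) (m∸[m∸n]≡n k≤n) ⟩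
    G p k n * (qfact p (n ∸ k) * qfact p k)              ≡⟨ cong (G p k n *_) (*-comm (qfact p (n ∸ k)) _) ⟩
    G p k n * (qfact p k * qfact p (n ∸ k))              ≡⟨ G*qfact≡qfact k k≤n ⟩
    qfact p n                                            ∎)
    where open ≡-Reasoning

  G-0 : ∀ n → G p 0 n ≡ 1
  G-0 n = *qfact≡qfact⇒G≡ {0} {n} {1} z≤n (trans (*-identityˡ _) (*-identityˡ _))

  G-n : ∀ n → G p n n ≡ 1
  G-n n = *qfact≡qfact⇒G≡ {n} {n} {1} ≤-refl
    (trans (*-identityˡ _) (trans (cong (λ z → qfact p n * qfact p z) (n∸n≡0 n)) (*-identityʳ _)))

  qint-+ : ∀ x y → qint p (x + y) ≡ qint p x + p ^ x * qint p y
  qint-+ zero    y = sym (*-identityˡ (qint p y))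
  qint-+ (suc x) y = begin
    suc (p * qint p (x + y))                  ≡⟨ cong (λ z → suc (p * z)) (qint-+ x y) ⟩
    suc (p * (qint p x + p ^ x * qint p y))   ≡⟨ cong suc (solve p (qint p x) (p ^ x) (qint p y)) ⟩
    suc (p * qint p x + p * p ^ x * qint p y) ∎
    where
    open ≡-Reasoning
    solve : ∀ a b c d → a * (b + c * d) ≡ a * b + a * c * d
    solve = solve-∀

  module q-Pascal (a b : ℕ) where
    m = a + suc b

    [a+1] [b+1] : ℕ
    [a+1] = qint p (suc a)
    [b+1] = qint p (suc b)

    denominator : ℕ
    denominator = qfact p (suc a) * qfact p (suc b)

    G⁺ G₀ G₁ : ℕ
    G⁺ = G p (suc a) (suc m)
    G₀ = G p a m
    G₁ = G p (suc a) m

    G⁺-factorial : G⁺ * denominator ≡ qint p (suc m) * qfact p m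
    G⁺-factorial = subst (λ z → G⁺ * (qfact p (suc a) * qfact p z) ≡ qfact p (suc m)) (m+n∸m≡n a (suc b))
                         (G*qfact≡qfact {n = suc m} (suc a) (s≤s (m≤m+n a (suc b))))

    G₀-factorial : G₀ * (qfact p a * ([b+1] * qfact p b)) ≡ qfact p m
    G₀-factorial = subst (λ z → G₀ * (qfact p a * qfact p z) ≡ qfact p m) (m+n∸m≡n a (suc b))
                         (G*qfact≡qfact {n = m} a (m≤m+n a (suc b)))

    G₁-factorial : G₁ * (([a+1] * qfact p a) * qfact p b) ≡ qfact p m
    G₁-factorial = subst (λ z → G₁ * (qfact p (suc a) * qfact p z) ≡ qfact p m) m∸[a+1]≡b
                         (G*qfact≡qfact {n = m} (suc a) (subst (suc a ≤_) (sym (+-suc a b)) (s≤s (m≤m+n a b))))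
      where
      m∸[a+1]≡b : m ∸ suc a ≡ b
      m∸[a+1]≡b = trans (cong (_∸ suc a) (+-suc a b)) (m+n∸m≡n a b)

    -- [m+1] = [a+1] + p^{a+1} [b+1]
    pascalˡ : G⁺ ≡ G₀ + p ^ suc a * G₁
    pascalˡ = *-cancelʳ-≡ G⁺ (G₀ + p ^ suc a * G₁) denominator {{qfact2-nz p (suc a) (suc b)}} (begin
      G⁺ * denominator                                  ≡⟨ G⁺-factorial ⟩
      qint p (suc m) * qfact p m                        ≡⟨ cong (_* qfact p m) (qint-+ (suc a) (suc b)) ⟩
      ([a+1] + p ^ suc a * [b+1]) * qfact p m           ≡⟨ distrib [a+1] [b+1] (p ^ suc a) (qfact p m) ⟩
      [a+1] * qfact p m + p ^ suc a * [b+1] * qfact p m ≡⟨ cong₂ (λ u w → [a+1] * u + p ^ suc a * [b+1] * w)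
                                                                 (sym G₀-factorial) (sym G₁-factorial) ⟩
      [a+1] * (G₀ * (qfact p a * ([b+1] * qfact p b)))
        + p ^ suc a * [b+1] * (G₁ * (([a+1] * qfact p a) * qfact p b))
                                                        ≡⟨ factor G₀ G₁ [a+1] [b+1] (qfact p a) (qfact p b) (p ^ suc a) ⟩
      (G₀ + p ^ suc a * G₁) * denominator               ∎)
      where
      open ≡-Reasoning
      distrib : ∀ x y c d → (x + c * y) * d ≡ x * d + c * y * d
      distrib = solve-∀
      factor : ∀ X Y Ia Ib fa fb P →
               Ia * (X * (fa * (Ib * fb))) + P * Ib * (Y * ((Ia * fa) * fb)) ≡ (X + P * Y) * ((Ia * fa) * (Ib * fb))
      factor = solve-∀

    -- [m+1] = [b+1] + p^{b+1} [a+1]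
    pascalʳ : G⁺ ≡ p ^ (suc m ∸ suc a) * G₀ + G₁
    pascalʳ = trans (*-cancelʳ-≡ G⁺ (p ^ suc b * G₀ + G₁) denominator {{qfact2-nz p (suc a) (suc b)}} (begin
      G⁺ * denominator                                  ≡⟨ G⁺-factorial ⟩
      qint p (suc m) * qfact p m                        ≡⟨ cong (_* qfact p m) [m+1]≡[b+1]+p^[b+1][a+1] ⟩
      ([b+1] + p ^ suc b * [a+1]) * qfact p m           ≡⟨ distrib [b+1] [a+1] (p ^ suc b) (qfact p m) ⟩
      [b+1] * qfact p m + p ^ suc b * [a+1] * qfact p m ≡⟨ cong₂ (λ u w → [b+1] * u + p ^ suc b * [a+1] * w)
                                                                 (sym G₁-factorial) (sym G₀-factorial) ⟩
      [b+1] * (G₁ * (([a+1] * qfact p a) * qfact p b))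
        + p ^ suc b * [a+1] * (G₀ * (qfact p a * ([b+1] * qfact p b)))
                                                        ≡⟨ factor G₀ G₁ [a+1] [b+1] (qfact p a) (qfact p b) (p ^ suc b) ⟩
      (p ^ suc b * G₀ + G₁) * denominator               ∎))
      (cong (λ z → p ^ z * G₀ + G₁) (sym (m+n∸m≡n a (suc b))))
      where
      open ≡-Reasoning
      [m+1]≡[b+1]+p^[b+1][a+1] : qint p (suc m) ≡ [b+1] + p ^ suc b * [a+1]
      [m+1]≡[b+1]+p^[b+1][a+1] =
        trans (cong (λ z → qint p (suc z)) (trans (+-suc a b) (trans (cong suc (+-comm a b)) (sym (+-suc b a)))))
              (qint-+ (suc b) (suc a))
      distrib : ∀ x y c d → (x + c * y) * d ≡ x * d + c * y * d
      distrib = solve-∀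
      factor : ∀ X Y Ia Ib fa fb P →
               Ib * (Y * ((Ia * fa) * fb)) + P * Ia * (X * (fa * (Ib * fb))) ≡ (P * X + Y) * ((Ia * fa) * (Ib * fb))
      factor = solve-∀

  G-pascal : ∀ m k → k ≤ suc m →
             (G p k (suc m) ≡ Gpred p k (suc m) + p ^ k * G p k m)
             × (G p k (suc m) ≡ p ^ (suc m ∸ k) * Gpred p k (suc m) + G p k m)
  G-pascal m zero    _ rewrite G-0 (suc m) | G-0 m = refl , sym (cong (_+ 1) (*-zeroʳ (p ^ suc m)))
  G-pascal m (suc a) (s≤s a≤m) with <-cmp a m
  ... | tri≈ _ refl _ rewrite G-n (suc m) | G-n m | G-> {suc m} {m} ≤-refl | n∸n≡0 m =
    sym (cong suc (*-zeroʳ (p ^ suc m))) , refl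
  ... | tri> _ _ m<a = ⊥-elim (<⇒≱ m<a a≤m)
  ... | tri< a<m _ _ = subst (λ m → (G p (suc a) (suc m) ≡ G p a m + p ^ suc a * G p (suc a) m)
                                    × (G p (suc a) (suc m) ≡ p ^ (suc m ∸ suc a) * G p a m + G p (suc a) m))
                             a+[b+1]≡m (q-Pascal.pascalˡ a b , q-Pascal.pascalʳ a b)
    where
    b = m ∸ suc a
    a+[b+1]≡m : a + suc b ≡ m
    a+[b+1]≡m = trans (+-suc a b) (m+[n∸m]≡n a<m)

  Gpred-complement : ∀ m k → k ≤ suc m → Gpred p (suc m ∸ k) (suc m) ≡ G p k m
  Gpred-complement m k k≤m+1 with k ≤? m
  ... | yes k≤m = trans (cong (λ z → Gpred p z (suc m)) (+-∸-assoc 1 k≤m)) (G-complement k≤m)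
  ... | no  k≰m with ≤-antisym k≤m+1 (≰⇒> k≰m)
  ...   | refl rewrite n∸n≡0 m = sym (G-> {suc m} {m} ≤-refl)

  G-duality : ∀ n k l → k ≤ n → l ≤ n →
              (G p k n + (p ^ l ∸ 1) * Gpred p k n) * p ^ n
              ≡ p ^ (k + l) * (G p (n ∸ k) n + (p ^ (n ∸ l) ∸ 1) * Gpred p (n ∸ k) n)
  G-duality zero    zero zero z≤n z≤n = *-comm _ 1
  G-duality (suc m) k    l    k≤n l≤n = begin
    (Z + A * X) * N                               ≡⟨ cong (λ z → (z + A * X) * N) (proj₁ pascal) ⟩
    ((X + e * Y) + A * X) * N                     ≡⟨ solve₁ X Y A e N ⟩
    (A + 1) * X * N + e * Y * N                   ≡⟨ cong (λ z → z * X * N + e * Y * N) A+1≡g ⟩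
    g * X * N + e * Y * N                         ≡⟨ cong₂ (λ u w → g * X * u + e * Y * w) (sym e*f≡N)
                                                           (trans (sym g*h≡N) (cong (g *_) (sym B+1≡h))) ⟩
    g * X * (e * f) + e * Y * (g * (B + 1))       ≡⟨ solve₂ X Y B e f g ⟩
    (e * g) * ((f * X + Y) + B * Y)               ≡⟨ cong₂ (λ u w → u * (w + B * Y)) (sym (^-distribˡ-+-* p k l))
                                                           (sym (proj₂ pascal)) ⟩
    p ^ (k + l) * (Z + B * Y)                     ≡⟨ cong₂ (λ u w → p ^ (k + l) * (u + B * w))
                                                           (sym (G-complement k≤n)) (sym (Gpred-complement m k k≤n)) ⟩
    p ^ (k + l) * (G p (n ∸ k) n + B * Gpred p (n ∸ k) n) ∎
    where
    open ≡-Reasoning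
    n = suc m
    Z = G p k n
    X = Gpred p k n
    Y = G p k m
    N = p ^ n
    e = p ^ k
    f = p ^ (n ∸ k)
    g = p ^ l
    h = p ^ (n ∸ l)
    A = g ∸ 1
    B = h ∸ 1
    pascal = G-pascal m k k≤n
    e*f≡N : e * f ≡ N
    e*f≡N = trans (sym (^-distribˡ-+-* p k (n ∸ k))) (cong (p ^_) (m+[n∸m]≡n k≤n))
    g*h≡N : g * h ≡ N
    g*h≡N = trans (sym (^-distribˡ-+-* p l (n ∸ l))) (cong (p ^_) (m+[n∸m]≡n l≤n))
    A+1≡g : A + 1 ≡ g
    A+1≡g = m∸n+n≡m (m^n>0 p l)
    B+1≡h : B + 1 ≡ h
    B+1≡h = m∸n+n≡m (m^n>0 p (n ∸ l))
    solve₁ : ∀ X Y A e N → ((X + e * Y) + A * X) * N ≡ (A + 1) * X * N + e * Y * N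
    solve₁ = solve-∀
    solve₂ : ∀ X Y B e f g → g * X * (e * f) + e * Y * (g * (B + 1)) ≡ (e * g) * ((f * X + Y) + B * Y)
    solve₂ = solve-∀

lemma3p2 : (p n k l : ℕ) (pr : Prime p) → k ≤ n → l ≤ n →
    (U : List (Vec (Fin p) n)) →
    LinAlg.isSubspace p {{prime⇒nonZero pr}} U ≡ true →
    LinAlg.hasDim p {{prime⇒nonZero pr}} U l ≡ true →
    (U' : List (Vec (Fin p) n)) →
    LinAlg.isSubspace p {{prime⇒nonZero pr}} U' ≡ true →
    LinAlg.hasDim p {{prime⇒nonZero pr}} U' (n ∸ l) ≡ true →
    (LinAlg.ν p {{prime⇒nonZero pr}} U k ≡ G p k n + (p ^ l ∸ 1) * Gpred p k n)
    × (LinAlg.ν p {{prime⇒nonZero pr}} U k * p ^ n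
    ≡ p ^ (k + l) * LinAlg.ν p {{prime⇒nonZero pr}} U' (n ∸ k))
lemma3p2 p n k l pr k≤n l≤n U subU dimU U' subU' dimU' = νU≡ , (begin
  ν U k * p ^ n                                                             ≡⟨ cong (_* p ^ n) νU≡ ⟩
  (G p k n + (p ^ l ∸ 1) * Gpred p k n) * p ^ n                             ≡⟨ G-duality p pr n k l k≤n l≤n ⟩
  p ^ (k + l) * (G p (n ∸ k) n + (p ^ (n ∸ l) ∸ 1) * Gpred p (n ∸ k) n)   ≡⟨ cong (p ^ (k + l) *_) (sym νU'≡) ⟩
  p ^ (k + l) * ν U' (n ∸ k)                                                ∎)
  where
  open ≡-Reasoning
  open LinAlg p {{prime⇒nonZero pr}} using (ν)
  νU≡ = ν≡ p pr U k l k≤n subU dimU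
  νU'≡ = ν≡ p pr U' (n ∸ k) (n ∸ l) (m∸n≤m n k) subU' dimU'
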